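{- Fix $r\ge1$. For $n,k\ge0$ let $p_n^{(k)}$ be the number of two-stack-sortable $k$-tuple $r$-permutations $(\alpha_1,\dots,\alpha_k)$ of $[n]$, where components are allowed to be empty. Let $p_k=\sum_{n\ge0}p_n^{(k)}x^n$ and $P=\sum_{k\ge0}p_k\bar z^{\,k}$. Then $$P=\frac{1}{1-\bar z}+\frac{xP}{\bar z^{\,r}}\left(P-\sum_{i=0}^r p_i\bar z^{\,i}\right),$$ and $P$ is uniquely determined as a power series in $x$ and $\bar z$ by this functional equation.
   Context: An $r$-permutation of a finite set $A$ of positive integers is a word in which each element of $A$ appears exactly $r$ times such that whenever $i<j<k$ and $a_i=a_k$ we have $a_j\le a_i$. A $k$-tuple $r$-permutation of $[n]$ is a tuple $(\alpha_1,\dots,\alpha_k)$ of words whose concatenation is an $r$-permutation of $[n]$ and in which every letter appears in only one $\alpha_i$. Stack sorting $S$: on words with distinct letters, $S(\emptyset)=\emptyset$ and $S(\pi_lm\pi_r)=S(\pi_l)S(\pi_r)m$ with $m$ the largest letter; on a nonempty $r$-permutation with largest letter $m$, written $\alpha_1m\alpha_2m\cdots m\alpha_{r+1}$, $S(\pi)=S(\alpha_1)\cdots S(\alpha_{r+1})m$; $S(\emptyset)=\emptyset$. The tuple is two-stack-sortable if $S(S(\alpha_1)S(\alpha_2)\cdots S(\alpha_k))=12\cdots n$. (For $k=0$ there is only the empty tuple, with $n=0$.) -}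

module Defs where

open import Data.Bool using (Bool; true; false; _∧_; _∨_; not; if_then_else_)
open import Data.Nat using (ℕ; zero; suc; _+_; _*_; _∸_; _⊔_; _≡ᵇ_; _≤ᵇ_; _<ᵇ_)
open import Data.List using (List; []; _∷_; _++_; map; concat; concatMap; length; filter; foldr; upTo)
open import Data.Bool.ListAction using (all; any)
open import Data.Integer using (ℤ; +_) renaming (_+_ to _+ℤ_; _*_ to _*ℤ_; _-_ to _-ℤ_)

-- Words are lists of natural numbers (letters are positive integers).

Word : Set
Word = List ℕ

-- i-th letter of a word (0-based; default 0 outside the range)
at : Word → ℕ → ℕ
at []       _       = 0
at (x ∷ _)  zero    = x
at (_ ∷ xs) (suc i) = at xs i

occ : ℕ → Word → ℕ
occ a w = length (filter (λ x → a Data.Nat.≟ x) w)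

occursᵇ : ℕ → Word → Bool
occursᵇ a w = any (λ x → a ≡ᵇ x) w

range : ℕ → List ℕ
range n = map suc (upTo n)

lettersInᵇ : ℕ → Word → Bool
lettersInᵇ n w = all (λ x → (1 ≤ᵇ x) ∧ (x ≤ᵇ n)) w

eachExactlyᵇ : ℕ → ℕ → Word → Bool
eachExactlyᵇ r n w = all (λ a → occ a w ≡ᵇ r) (range n)

patternᵇ : Word → Bool
patternᵇ w =
  all (λ i → all (λ j → all (λ k →
      not ((i <ᵇ j) ∧ (j <ᵇ k)) ∨ not (at w i ≡ᵇ at w k) ∨ (at w j ≤ᵇ at w i))
    idx) idx) idx
  where idx = upTo (length w)

isRPermᵇ : ℕ → ℕ → Word → Bool
isRPermᵇ r n w = lettersInᵇ n w ∧ eachExactlyᵇ r n w ∧ patternᵇ w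

-- S(∅) = ∅; for a nonempty word with largest letter m, written
-- α₁ m α₂ m ⋯ m α_{t+1} (splitting at all occurrences of m),
-- S = S(α₁) ⋯ S(α_{t+1}) m.  For words with distinct letters this is
-- S(π_l m π_r) = S(π_l) S(π_r) m; for r-permutations it is the paper's rule.

maxL : Word → ℕ
maxL = foldr _⊔_ 0

consHead : ℕ → List Word → List Word
consHead x []       = (x ∷ []) ∷ []
consHead x (w ∷ ws) = (x ∷ w) ∷ ws

splitOnLetter : ℕ → Word → List Word
splitOnLetter m []       = [] ∷ []
splitOnLetter m (x ∷ xs) =
  if x ≡ᵇ m then [] ∷ splitOnLetter m xs else consHead x (splitOnLetter m xs)

-- fuel-bounded version (fuel = length suffices since every piece is shorter)
stackSortF : ℕ → Word → Word
stackSortF _       []       = []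
stackSortF zero    (_ ∷ _)  = []
stackSortF (suc f) (x ∷ xs) =
  concat (map (stackSortF f) (splitOnLetter (maxL (x ∷ xs)) (x ∷ xs))) ++ (maxL (x ∷ xs) ∷ [])

S : Word → Word
S w = stackSortF (length w) w

words : ℕ → ℕ → List Word
words zero    n = [] ∷ []
words (suc m) n = concatMap (λ a → map (a ∷_) (words m n)) (range n)

tuples : ℕ → ℕ → ℕ → List (List Word)
tuples zero    zero      n = [] ∷ []
tuples zero    (suc _)   n = []
tuples (suc k) len       n =
  concatMap (λ m → concatMap (λ w → map (w ∷_) (tuples k (len ∸ m) n)) (words m n))
            (upTo (suc len))

listEqᵇ : Word → Word → Bool
listEqᵇ []       []       = true
listEqᵇ (x ∷ xs) (y ∷ ys) = (x ≡ᵇ y) ∧ listEqᵇ xs ys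
listEqᵇ _        _        = false

disjointᵇ : ℕ → List Word → Bool
disjointᵇ n t = all (λ a → length (filter (λ w → Data.Bool._≟_ (occursᵇ a w) true) t) ≤ᵇ 1) (range n)

isTupleRPermᵇ : ℕ → ℕ → List Word → Bool
isTupleRPermᵇ r n t = isRPermᵇ r n (concat t) ∧ disjointᵇ n t

twoStackSortableᵇ : ℕ → List Word → Bool
twoStackSortableᵇ n t = listEqᵇ (S (concat (map S t))) (range n)

-- p_n^{(k)} : number of two-stack-sortable k-tuple r-permutations of [n]
-- (every such tuple has total length r*n and letters in [n], so it occurs
-- exactly once in  tuples k (r * n) n)
pCount : ℕ → ℕ → ℕ → ℕ
pCount r n k =
  length (filter (λ t → Data.Bool._≟_ (isTupleRPermᵇ r n t ∧ twoStackSortableᵇ n t) true)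
                 (tuples k (r * n) n))

-- Formal power series in x and z̄ with integer coefficients:
-- F n k = coefficient of x^n z̄^k.

PS : Set
PS = ℕ → ℕ → ℤ

ΣZ : List ℕ → (ℕ → ℤ) → ℤ
ΣZ xs f = foldr (λ i acc → f i +ℤ acc) (+ 0) xs

Pgf : ℕ → PS
Pgf r n k = + pCount r n k

-- 1/(1 - z̄)
geomZ : PS
geomZ zero    k = + 1
geomZ (suc n) k = + 0

_⊕_ : PS → PS → PS
(F ⊕ G) n k = F n k +ℤ G n k

_⊖_ : PS → PS → PS
(F ⊖ G) n k = F n k -ℤ G n k

_⊛_ : PS → PS → PS
(F ⊛ G) n k = ΣZ (upTo (suc n)) (λ i → ΣZ (upTo (suc k)) (λ j → F i j *ℤ G (n ∸ i) (k ∸ j)))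

xTimes : PS → PS
xTimes F zero    k = + 0
xTimes F (suc n) k = F n k

-- Σ_{i=0}^r f_i z̄^i, where f_i = [z̄^i] F  (a power series in x)
truncZ : ℕ → PS → PS
truncZ r F n k = if k ≤ᵇ r then F n k else + 0

-- division by z̄^r (applied only to series divisible by z̄^r)
divZ : ℕ → PS → PS
divZ r F n k = F n (k + r)

rhs : ℕ → PS → PS
rhs r F = geomZ ⊕ xTimes (F ⊛ divZ r (F ⊖ truncZ r F))

SatisfiesEq : ℕ → PS → Set
SatisfiesEq r F = ∀ n k → F n k Relation.Binary.PropositionalEquality.≡ rhs r F n k
  where import Relation.Binary.PropositionalEquality

module Submission where

-- Let m = n + 1. In a tuple r-permutation of [m] all r copies of m lie in one component, which they
-- cut into pieces β₀, …, βᵣ; write the tuple as (A, β₀ m β₁ ⋯ m βᵣ, B) and let L = (A, β₀, …, βᵣ).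
-- Stack sorting sends m to the end of that component, so, writing sortEach (α₁, …, αₖ) for
-- S α₁ ⋯ S αₖ, S (sortEach t) = S (sortEach L) S (sortEach B) m. Hence t is two-stack-sortable iff L is a
-- two-stack-sortable tuple r-permutation of [i] and B, shifted down by i, one of [n - i]. This
-- bijection gives p⁽ᵏ⁾ₙ₊₁ = Σ_{a ≤ n, j < k} p⁽ʲ⁾ₐ p⁽ᵏ⁻ʲ⁺ʳ⁾ₙ₋ₐ, the coefficient of xⁿ⁺¹ z̄ᵏ on
-- the right of the functional equation, while p⁽ᵏ⁾₀ = 1 accounts for 1/(1 - z̄). That coefficient
-- only involves coefficients of x-degree at most n, so the equation determines P by induction on n.

open import Defs
open import Data.Bool using (Bool; true; false; _∧_; _∨_; not; T; if_then_else_)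
import Data.Bool as Bool
open import Data.Bool.ListAction using (all)
open import Data.Empty using (⊥; ⊥-elim)
open import Data.Integer using (ℤ) renaming (+_ to ι_; _+_ to _+ℤ_; _*_ to _*ℤ_; _-_ to _-ℤ_)
import Data.Integer.Properties as ℤP
open import Data.List
  using (List; []; _∷_; _++_; [_]; map; concat; concatMap; length; filter; upTo;
         take; drop; replicate; cartesianProduct)
import Data.List.Properties as LP
open import Data.List.Membership.Propositional using (_∈_; _∉_)
open import Data.List.Membership.Propositional.Properties
  using (∈-map⁺; ∈-map⁻; ∈-++⁺ˡ; ∈-++⁺ʳ; ∈-++⁻; ∈-upTo⁺; ∈-upTo⁻; ∈-filter⁺; ∈-filter⁻;
         ∈-∃++; ∈-concat⁺′; ∈-concat⁻′; ∈-cartesianProduct⁺; ∈-cartesianProduct⁻)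
open import Data.List.Relation.Unary.Any using (Any; here; there)
open import Data.List.Relation.Unary.All using (All; []; _∷_)
import Data.List.Relation.Unary.All as All
import Data.List.Relation.Unary.All.Properties as AllP
import Data.List.Relation.Unary.AllPairs as AllPairs
open import Data.List.Relation.Unary.Unique.Propositional using (Unique)
import Data.List.Relation.Unary.Unique.Propositional.Properties as UniqueP
open import Data.Nat.ListAction using (sum)
open import Data.Nat
  using (ℕ; zero; suc; _+_; _*_; _∸_; _⊔_; _≤_; _≰_; _<_; z≤n; s≤s; _≡ᵇ_; _≤ᵇ_; _<ᵇ_; _≟_; _≤?_)
import Data.Nat.Properties as ℕP
open import Data.Product using (∃; ∃₂; _×_; _,_; proj₁; proj₂)
open import Data.Sum using (_⊎_; inj₁; inj₂; [_,_]′; map₂)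
open import Data.Unit using (⊤; tt)
open import Function using (_∘_; id; case_of_)
open import Relation.Binary.Definitions using (tri<; tri≈; tri>)
open import Relation.Binary.PropositionalEquality
  using (_≡_; _≢_; refl; sym; trans; cong; cong₂; subst; module ≡-Reasoning)
open import Relation.Nullary using (yes; no; ¬?)
open ≡-Reasoning

-- Boolean reflection

∧-trueˡ : ∀ {a b} → (a ∧ b) ≡ true → a ≡ true
∧-trueˡ {true} _ = refl

∧-trueʳ : ∀ {a b} → (a ∧ b) ≡ true → b ≡ true
∧-trueʳ {true} e = e

∧-true : ∀ {a b} → a ≡ true → b ≡ true → (a ∧ b) ≡ true
∧-true refl refl = refl

false≢true : false ≢ true
false≢true ()

T⇒≡true : ∀ {b} → T b → b ≡ true
T⇒≡true {true} _ = refl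

≡true⇒T : ∀ {b} → b ≡ true → T b
≡true⇒T refl = tt

≡ᵇ-true⇒≡ : ∀ {m n} → (m ≡ᵇ n) ≡ true → m ≡ n
≡ᵇ-true⇒≡ {m} {n} e = ℕP.≡ᵇ⇒≡ m n (≡true⇒T e)

≡⇒≡ᵇ-true : ∀ {m n} → m ≡ n → (m ≡ᵇ n) ≡ true
≡⇒≡ᵇ-true {m} {n} e = T⇒≡true (ℕP.≡⇒≡ᵇ m n e)

≢⇒≡ᵇ-false : ∀ {m n} → m ≢ n → (m ≡ᵇ n) ≡ false
≢⇒≡ᵇ-false {m} {n} m≢n with m ≡ᵇ n in eq
... | true  = ⊥-elim (m≢n (≡ᵇ-true⇒≡ eq))
... | false = refl

≡ᵇ-sym : ∀ m n → (m ≡ᵇ n) ≡ (n ≡ᵇ m)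
≡ᵇ-sym zero    zero    = refl
≡ᵇ-sym zero    (suc n) = refl
≡ᵇ-sym (suc m) zero    = refl
≡ᵇ-sym (suc m) (suc n) = ≡ᵇ-sym m n

≤ᵇ-true⇒≤ : ∀ {m n} → (m ≤ᵇ n) ≡ true → m ≤ n
≤ᵇ-true⇒≤ {m} {n} e = ℕP.≤ᵇ⇒≤ m n (≡true⇒T e)

≤⇒≤ᵇ-true : ∀ {m n} → m ≤ n → (m ≤ᵇ n) ≡ true
≤⇒≤ᵇ-true m≤n = T⇒≡true (ℕP.≤⇒≤ᵇ m≤n)

<ᵇ-true⇒< : ∀ {m n} → (m <ᵇ n) ≡ true → m < n
<ᵇ-true⇒< {m} {n} e = ℕP.<ᵇ⇒< m n (≡true⇒T e)

<⇒<ᵇ-true : ∀ {m n} → m < n → (m <ᵇ n) ≡ true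
<⇒<ᵇ-true m<n = T⇒≡true (ℕP.<⇒<ᵇ m<n)

all-true⁻ : ∀ {A : Set} (p : A → Bool) xs → all p xs ≡ true → ∀ {x} → x ∈ xs → p x ≡ true
all-true⁻ p (y ∷ xs) e (here refl) = ∧-trueˡ e
all-true⁻ p (y ∷ xs) e (there x∈) = all-true⁻ p xs (∧-trueʳ {p y} e) x∈

all-true⁺ : ∀ {A : Set} (p : A → Bool) xs → (∀ {x} → x ∈ xs → p x ≡ true) → all p xs ≡ true
all-true⁺ p []       h = refl
all-true⁺ p (y ∷ xs) h = ∧-true (h (here refl)) (all-true⁺ p xs (h ∘ there))

occursᵇ⇒∈ : ∀ a w → occursᵇ a w ≡ true → a ∈ w
occursᵇ⇒∈ a (x ∷ w) e with a ≡ᵇ x in eq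
... | true  = here (≡ᵇ-true⇒≡ eq)
... | false = there (occursᵇ⇒∈ a w e)

∈⇒occursᵇ : ∀ a w → a ∈ w → occursᵇ a w ≡ true
∈⇒occursᵇ a (x ∷ w) (here refl) rewrite ≡⇒≡ᵇ-true {a} refl = refl
∈⇒occursᵇ a (x ∷ w) (there a∈) with a ≡ᵇ x
... | true  = refl
... | false = ∈⇒occursᵇ a w a∈

occursᵇ-false⇒∉ : ∀ a w → occursᵇ a w ≡ false → a ∉ w
occursᵇ-false⇒∉ a w e a∈ = false≢true (trans (sym e) (∈⇒occursᵇ a w a∈))

∉⇒occursᵇ-false : ∀ a w → a ∉ w → occursᵇ a w ≡ false
∉⇒occursᵇ-false a w a∉ with occursᵇ a w in eq
... | true  = ⊥-elim (a∉ (occursᵇ⇒∈ a w eq))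
... | false = refl

listEqᵇ⇒≡ : ∀ xs ys → listEqᵇ xs ys ≡ true → xs ≡ ys
listEqᵇ⇒≡ []       []       e = refl
listEqᵇ⇒≡ (x ∷ xs) (y ∷ ys) e with ≡ᵇ-true⇒≡ {x} {y} (∧-trueˡ e)
... | refl = cong (x ∷_) (listEqᵇ⇒≡ xs ys (∧-trueʳ {x ≡ᵇ y} e))
listEqᵇ⇒≡ []       (_ ∷ _)  ()
listEqᵇ⇒≡ (_ ∷ _)  []       ()

listEqᵇ-refl : ∀ xs → listEqᵇ xs xs ≡ true
listEqᵇ-refl []       = refl
listEqᵇ-refl (x ∷ xs) = ∧-true (≡⇒≡ᵇ-true {x} refl) (listEqᵇ-refl xs)

-- The pattern condition


InRange : ℕ → ℕ → Set
InRange n x = 1 ≤ x × x ≤ n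

∈-range⁻ : ∀ {n a} → a ∈ range n → InRange n a
∈-range⁻ a∈ with ∈-map⁻ suc a∈
... | x , x∈ , refl = s≤s z≤n , ∈-upTo⁻ x∈

∈-range⁺ : ∀ {n a} → InRange n a → a ∈ range n
∈-range⁺ {a = suc a} (_ , a≤n) = ∈-map⁺ suc (∈-upTo⁺ a≤n)

at-∈ : ∀ w k → k < length w → at w k ∈ w
at-∈ (x ∷ w) zero    _         = here refl
at-∈ (x ∷ w) (suc k) (s≤s k<) = there (at-∈ w k k<)

∈⇒at : ∀ {a} w → a ∈ w → ∃ λ k → k < length w × at w k ≡ a
∈⇒at (x ∷ w) (here refl) = 0 , s≤s z≤n , refl
∈⇒at (x ∷ w) (there a∈) with ∈⇒at w a∈
... | k , k< , e = suc k , s≤s k< , e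

-- Nested is a recursive form of the pattern condition of r-permutations; Nestedⁱ is its index form.
CappedBy : ℕ → Word → Set
CappedBy x []      = ⊤
CappedBy x (y ∷ w) = (x ∈ w → y ≤ x) × CappedBy x w

Nested : Word → Set
Nested []      = ⊤
Nested (x ∷ w) = CappedBy x w × Nested w

CappedByⁱ : ℕ → Word → Set
CappedByⁱ x w = ∀ j k → j < k → k < length w → at w k ≡ x → at w j ≤ x

Nestedⁱ : Word → Set
Nestedⁱ w = ∀ i j k → i < j → j < k → k < length w → at w i ≡ at w k → at w j ≤ at w i

CappedBy⇒CappedByⁱ : ∀ x w → CappedBy x w → CappedByⁱ x w
CappedBy⇒CappedByⁱ x (y ∷ w) (h , hs) zero    (suc k) _         (s≤s k<) e = h (subst (_∈ w) e (at-∈ w k k<))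
CappedBy⇒CappedByⁱ x (y ∷ w) (h , hs) (suc j) (suc k) (s≤s j<k) (s≤s k<) e = CappedBy⇒CappedByⁱ x w hs j k j<k k< e

CappedByⁱ⇒CappedBy : ∀ x w → CappedByⁱ x w → CappedBy x w
CappedByⁱ⇒CappedBy x []      h = tt
CappedByⁱ⇒CappedBy x (y ∷ w) h =
    (λ x∈ → let (k , k< , e) = ∈⇒at w x∈ in h 0 (suc k) (s≤s z≤n) (s≤s k<) e)
  , CappedByⁱ⇒CappedBy x w (λ j k j<k k< e → h (suc j) (suc k) (s≤s j<k) (s≤s k<) e)

Nestedⁱ⇒Nested : ∀ w → Nestedⁱ w → Nested w
Nestedⁱ⇒Nested []      p = tt
Nestedⁱ⇒Nested (x ∷ w) p =
    CappedByⁱ⇒CappedBy x w (λ j k j<k k< e → p 0 (suc j) (suc k) (s≤s z≤n) (s≤s j<k) (s≤s k<) (sym e))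
  , Nestedⁱ⇒Nested w (λ i j k i<j j<k k< e → p (suc i) (suc j) (suc k) (s≤s i<j) (s≤s j<k) (s≤s k<) e)

Nested⇒Nestedⁱ : ∀ w → Nested w → Nestedⁱ w
Nested⇒Nestedⁱ (x ∷ w) (h , p) zero    (suc j) (suc k) _         (s≤s j<k) (s≤s k<) e =
  CappedBy⇒CappedByⁱ x w h j k j<k k< (sym e)
Nested⇒Nestedⁱ (x ∷ w) (h , p) (suc i) (suc j) (suc k) (s≤s i<j) (s≤s j<k) (s≤s k<) e =
  Nested⇒Nestedⁱ w p i j k i<j j<k k< e

patternᵇ⇔Nestedⁱ : ∀ w → (patternᵇ w ≡ true → Nestedⁱ w) × (Nestedⁱ w → patternᵇ w ≡ true)
patternᵇ⇔Nestedⁱ w = to , from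
  where
  idx = upTo (length w)
  cond : ℕ → ℕ → ℕ → Bool
  cond i j k = not ((i <ᵇ j) ∧ (j <ᵇ k)) ∨ not (at w i ≡ᵇ at w k) ∨ (at w j ≤ᵇ at w i)
  row : ℕ → ℕ → Bool
  row i j = all (cond i j) idx
  plane : ℕ → Bool
  plane i = all (row i) idx

  implication⁻ : ∀ a b c → (not a ∨ not b ∨ c) ≡ true → a ≡ true → b ≡ true → c ≡ true
  implication⁻ true true c e refl refl = e

  implication⁺ : ∀ a b c → (a ≡ true → b ≡ true → c ≡ true) → (not a ∨ not b ∨ c) ≡ true
  implication⁺ false b     c h = refl
  implication⁺ true  false c h = refl
  implication⁺ true  true  c h = h refl refl

  to : patternᵇ w ≡ true → Nestedⁱ w
  to e i j k i<j j<k k< ik =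
    ≤ᵇ-true⇒≤ (implication⁻ _ _ _ (all-true⁻ (cond i j) idx (all-true⁻ (row i) idx (all-true⁻ plane idx e
        (∈-upTo⁺ (ℕP.<-trans i<j (ℕP.<-trans j<k k<)))) (∈-upTo⁺ (ℕP.<-trans j<k k<))) (∈-upTo⁺ k<))
      (∧-true (<⇒<ᵇ-true i<j) (<⇒<ᵇ-true j<k)) (≡⇒≡ᵇ-true ik))

  from : Nestedⁱ w → patternᵇ w ≡ true
  from p = all-true⁺ plane idx λ {i} _ → all-true⁺ (row i) idx λ {j} _ → all-true⁺ (cond i j) idx λ {k} k∈ →
    implication⁺ _ _ _ λ ijk ik →
      ≤⇒≤ᵇ-true (p i j k (<ᵇ-true⇒< (∧-trueˡ ijk)) (<ᵇ-true⇒< (∧-trueʳ {i <ᵇ j} ijk)) (∈-upTo⁻ k∈) (≡ᵇ-true⇒≡ ik))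

-- Tuple r-permutations

occ-++ : ∀ a u v → occ a (u ++ v) ≡ occ a u + occ a v
occ-++ a []      v = refl
occ-++ a (x ∷ u) v with a ≡ᵇ x
... | true  = cong suc (occ-++ a u v)
... | false = occ-++ a u v

∉⇒occ≡0 : ∀ a w → a ∉ w → occ a w ≡ 0
∉⇒occ≡0 a []      a∉ = refl
∉⇒occ≡0 a (x ∷ w) a∉ with a ≡ᵇ x in eq
... | true  = ⊥-elim (a∉ (here (≡ᵇ-true⇒≡ eq)))
... | false = ∉⇒occ≡0 a w (a∉ ∘ there)

occ-pos⇒∈ : ∀ a w → 1 ≤ occ a w → a ∈ w
occ-pos⇒∈ a (x ∷ w) pos with a ≡ᵇ x in eq
... | true  = here (≡ᵇ-true⇒≡ eq)
... | false = there (occ-pos⇒∈ a w pos)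

LettersIn : ℕ → Word → Set
LettersIn n w = All (InRange n) w

lettersInᵇ-sound : ∀ n w → lettersInᵇ n w ≡ true → LettersIn n w
lettersInᵇ-sound n []      e = []
lettersInᵇ-sound n (x ∷ w) e =
    (≤ᵇ-true⇒≤ (∧-trueˡ (∧-trueˡ e)) , ≤ᵇ-true⇒≤ (∧-trueʳ {1 ≤ᵇ x} (∧-trueˡ e)))
  ∷ lettersInᵇ-sound n w (∧-trueʳ {(1 ≤ᵇ x) ∧ (x ≤ᵇ n)} e)

lettersInᵇ-complete : ∀ n w → LettersIn n w → lettersInᵇ n w ≡ true
lettersInᵇ-complete n []      []                = refl
lettersInᵇ-complete n (x ∷ w) ((1≤x , x≤n) ∷ l) =
  ∧-true (∧-true (≤⇒≤ᵇ-true 1≤x) (≤⇒≤ᵇ-true x≤n)) (lettersInᵇ-complete n w l)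

EachExactly : ℕ → ℕ → Word → Set
EachExactly r n w = ∀ a → InRange n a → occ a w ≡ r

eachExactlyᵇ-sound : ∀ r n w → eachExactlyᵇ r n w ≡ true → EachExactly r n w
eachExactlyᵇ-sound r n w e a a∈ = ≡ᵇ-true⇒≡ (all-true⁻ (λ a → occ a w ≡ᵇ r) (range n) e (∈-range⁺ a∈))

eachExactlyᵇ-complete : ∀ r n w → EachExactly r n w → eachExactlyᵇ r n w ≡ true
eachExactlyᵇ-complete r n w h = all-true⁺ (λ a → occ a w ≡ᵇ r) (range n) λ a∈ → ≡⇒≡ᵇ-true (h _ (∈-range⁻ a∈))

Disjointᵗ : List Word → Set
Disjointᵗ []      = ⊤
Disjointᵗ (w ∷ t) = (∀ a → a ∈ w → a ∉ concat t) × Disjointᵗ t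

componentsContaining : ℕ → List Word → ℕ
componentsContaining a t = length (filter (λ w → Bool._≟_ (occursᵇ a w) true) t)

∉⇒componentsContaining≡0 : ∀ a t → a ∉ concat t → componentsContaining a t ≡ 0
∉⇒componentsContaining≡0 a []      a∉ = refl
∉⇒componentsContaining≡0 a (w ∷ t) a∉ rewrite ∉⇒occursᵇ-false a w (a∉ ∘ ∈-++⁺ˡ) =
  ∉⇒componentsContaining≡0 a t (a∉ ∘ ∈-++⁺ʳ w)

∈⇒componentsContaining-pos : ∀ a t → a ∈ concat t → 1 ≤ componentsContaining a t
∈⇒componentsContaining-pos a (w ∷ t) a∈ with occursᵇ a w in eq
... | true = s≤s z≤n
... | false with ∈-++⁻ w a∈
...   | inj₁ a∈w = ⊥-elim (occursᵇ-false⇒∉ a w eq a∈w)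
...   | inj₂ a∈t = ∈⇒componentsContaining-pos a t a∈t

componentsContaining-∷ : ∀ a w t → componentsContaining a t ≤ componentsContaining a (w ∷ t)
componentsContaining-∷ a w t with occursᵇ a w
... | true  = ℕP.n≤1+n _
... | false = ℕP.≤-refl

Disjointᵗ⇒componentsContaining≤1 : ∀ t → Disjointᵗ t → ∀ a → componentsContaining a t ≤ 1
Disjointᵗ⇒componentsContaining≤1 []      _        a = z≤n
Disjointᵗ⇒componentsContaining≤1 (w ∷ t) (d , ds) a with occursᵇ a w in eq
... | true rewrite ∉⇒componentsContaining≡0 a t (d a (occursᵇ⇒∈ a w eq)) = s≤s z≤n
... | false = Disjointᵗ⇒componentsContaining≤1 t ds a

componentsContaining≤1⇒Disjointᵗ : ∀ t → (∀ a → a ∈ concat t → componentsContaining a t ≤ 1) → Disjointᵗ t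
componentsContaining≤1⇒Disjointᵗ []      h = tt
componentsContaining≤1⇒Disjointᵗ (w ∷ t) h =
    (λ a a∈w a∈t → twice a a∈w a∈t)
  , componentsContaining≤1⇒Disjointᵗ t (λ a a∈ → ℕP.≤-trans (componentsContaining-∷ a w t) (h a (∈-++⁺ʳ w a∈)))
  where
  twice : ∀ a → a ∈ w → a ∈ concat t → ⊥
  twice a a∈w a∈t with h a (∈-++⁺ˡ a∈w)
  ... | ≤1 rewrite ∈⇒occursᵇ a w a∈w =
    ℕP.<-irrefl refl (ℕP.≤-trans (s≤s (∈⇒componentsContaining-pos a t a∈t)) ≤1)

disjointᵇ-sound : ∀ n t → LettersIn n (concat t) → disjointᵇ n t ≡ true → Disjointᵗ t
disjointᵇ-sound n t l e = componentsContaining≤1⇒Disjointᵗ t λ a a∈ →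
  ≤ᵇ-true⇒≤ (all-true⁻ (λ a → componentsContaining a t ≤ᵇ 1) (range n) e (∈-range⁺ (All.lookup l a∈)))

disjointᵇ-complete : ∀ n t → Disjointᵗ t → disjointᵇ n t ≡ true
disjointᵇ-complete n t d = all-true⁺ (λ a → componentsContaining a t ≤ᵇ 1) (range n)
  λ {a} _ → ≤⇒≤ᵇ-true (Disjointᵗ⇒componentsContaining≤1 t d a)

IsTupleRPerm : ℕ → ℕ → List Word → Set
IsTupleRPerm r n t = LettersIn n (concat t) × EachExactly r n (concat t) × Nested (concat t) × Disjointᵗ t

isTupleRPermᵇ-sound : ∀ r n t → isTupleRPermᵇ r n t ≡ true → IsTupleRPerm r n t
isTupleRPermᵇ-sound r n t e =
    letters
  , eachExactlyᵇ-sound r n w (∧-trueˡ e₂)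
  , Nestedⁱ⇒Nested w (proj₁ (patternᵇ⇔Nestedⁱ w) (∧-trueʳ {eachExactlyᵇ r n w} e₂))
  , disjointᵇ-sound n t letters (∧-trueʳ {isRPermᵇ r n w} e)
  where
  w = concat t
  e₁ = ∧-trueˡ e
  e₂ = ∧-trueʳ {lettersInᵇ n w} e₁
  letters = lettersInᵇ-sound n w (∧-trueˡ e₁)

isTupleRPermᵇ-complete : ∀ r n t → IsTupleRPerm r n t → isTupleRPermᵇ r n t ≡ true
isTupleRPermᵇ-complete r n t (l , ex , p , d) =
  ∧-true (∧-true (lettersInᵇ-complete n w l)
                 (∧-true (eachExactlyᵇ-complete r n w ex) (proj₂ (patternᵇ⇔Nestedⁱ w) (Nested⇒Nestedⁱ w p))))
         (disjointᵇ-complete n t d)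
  where w = concat t

TwoStackSortable : ℕ → List Word → Set
TwoStackSortable n t = S (concat (map S t)) ≡ range n

deleteAll : ℕ → Word → Word
deleteAll a = filter (λ x → ¬? (a ≟ x))

length-deleteAll : ∀ a w → length w ≡ occ a w + length (deleteAll a w)
length-deleteAll a []      = refl
length-deleteAll a (x ∷ w) with a ≡ᵇ x
... | true  = cong suc (length-deleteAll a w)
... | false = trans (cong suc (length-deleteAll a w)) (sym (ℕP.+-suc (occ a w) _))

occ-deleteAll : ∀ a b w → b ≢ a → occ b (deleteAll a w) ≡ occ b w
occ-deleteAll a b []      b≢a = refl
occ-deleteAll a b (x ∷ w) b≢a with a ≡ᵇ x in eq
... | true with b ≡ᵇ x in eq′
...   | true  = ⊥-elim (b≢a (trans (≡ᵇ-true⇒≡ eq′) (sym (≡ᵇ-true⇒≡ eq))))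
...   | false = occ-deleteAll a b w b≢a
occ-deleteAll a b (x ∷ w) b≢a | false with b ≡ᵇ x
...   | true  = cong suc (occ-deleteAll a b w b≢a)
...   | false = occ-deleteAll a b w b≢a

LettersIn-deleteAll : ∀ n w → LettersIn (suc n) w → LettersIn n (deleteAll (suc n) w)
LettersIn-deleteAll n []      []                = []
LettersIn-deleteAll n (x ∷ w) ((1≤x , x≤) ∷ l) with suc n ≡ᵇ x in eq
... | true  = LettersIn-deleteAll n w l
... | false = (1≤x , ℕP.≤-pred (ℕP.≤∧≢⇒< x≤ λ x≡ → false≢true (trans (sym eq) (≡⇒≡ᵇ-true (sym x≡)))))
            ∷ LettersIn-deleteAll n w l

length-rperm : ∀ r n w → LettersIn n w → EachExactly r n w → length w ≡ r * n
length-rperm r zero    []      l                 ex = sym (ℕP.*-zeroʳ r)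
length-rperm r zero    (x ∷ w) ((1≤x , x≤0) ∷ _) ex = ⊥-elim (ℕP.<-irrefl refl (ℕP.≤-trans 1≤x x≤0))
length-rperm r (suc n) w       l                 ex = begin
    length w
  ≡⟨ length-deleteAll (suc n) w ⟩
    occ (suc n) w + length (deleteAll (suc n) w)
  ≡⟨ cong₂ _+_ (ex (suc n) (s≤s z≤n , ℕP.≤-refl)) (length-rperm r n _ (LettersIn-deleteAll n w l) each′) ⟩
    r + r * n
  ≡⟨ sym (ℕP.*-suc r n) ⟩
    r * suc n
  ∎
  where
  each′ : EachExactly r n (deleteAll (suc n) w)
  each′ a (1≤a , a≤n) =
    trans (occ-deleteAll (suc n) a w (λ e → ℕP.<-irrefl e (s≤s a≤n))) (ex a (1≤a , ℕP.m≤n⇒m≤1+n a≤n))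

-- Counting by bijection

∈-delete : ∀ {A : Set} {x y : A} (us vs : List A) → y ∈ us ++ x ∷ vs → y ≢ x → y ∈ us ++ vs
∈-delete []       vs (here y≡x)  y≢x = ⊥-elim (y≢x y≡x)
∈-delete []       vs (there y∈)  y≢x = y∈
∈-delete (u ∷ us) vs (here y≡u)  y≢x = here y≡u
∈-delete (u ∷ us) vs (there y∈)  y≢x = there (∈-delete us vs y∈ y≢x)

Unique-⊆⇒length≤ : ∀ {A : Set} {xs ys : List A} → Unique xs → (∀ {x} → x ∈ xs → x ∈ ys) → length xs ≤ length ys
Unique-⊆⇒length≤ {xs = []}     _              _   = z≤n
Unique-⊆⇒length≤ {xs = x ∷ xs} (x∉xs AllPairs.∷ uniq) sub with ∈-∃++ (sub (here refl))
... | us , vs , refl = subst (suc (length xs) ≤_) (sym (LP.length-++-sucʳ us x vs))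
  (s≤s (Unique-⊆⇒length≤ uniq λ y∈ →
    ∈-delete us vs (sub (there y∈)) (λ { refl → AllP.All¬⇒¬Any x∉xs y∈ })))

Unique-map⁺ : ∀ {A B : Set} {f : A → B} {xs : List A} → Unique xs →
              (∀ {x y} → x ∈ xs → y ∈ xs → f x ≡ f y → x ≡ y) → Unique (map f xs)
Unique-map⁺ {xs = []}     AllPairs.[]   inj = AllPairs.[]
Unique-map⁺ {f = f} {x ∷ xs} (x∉xs AllPairs.∷ uniq) inj =
    AllP.map⁺ (AllP.¬Any⇒All¬ xs (λ fx∈ → let (y , y∈ , fx≡fy) = find fx∈ in
                                        AllP.All¬⇒¬Any x∉xs (subst (_∈ xs) (sym (inj (here refl) (there y∈) fx≡fy)) y∈)))
  AllPairs.∷ Unique-map⁺ uniq (λ x∈ y∈ → inj (there x∈) (there y∈))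
  where
  find : ∀ {ys} → Any (λ y → f x ≡ f y) ys → ∃ λ y → y ∈ ys × f x ≡ f y
  find (here e)  = _ , here refl , e
  find (there p) = let (y , y∈ , e) = find p in y , there y∈ , e

Unique-inverses⇒length≡ : ∀ {A B : Set} {xs : List A} {ys : List B} → Unique xs → Unique ys →
  (f : A → B) (g : B → A) →
  (∀ {x} → x ∈ xs → f x ∈ ys × g (f x) ≡ x) →
  (∀ {y} → y ∈ ys → g y ∈ xs × f (g y) ≡ y) →
  length xs ≡ length ys
Unique-inverses⇒length≡ {xs = xs} {ys} uxs uys f g fg gf = ℕP.≤-antisym
  (embed f g fg uxs) (embed g f gf uys)
  where
  embed : ∀ {C D : Set} {cs : List C} {ds : List D} (h : C → D) (h⁻ : D → C) →
          (∀ {c} → c ∈ cs → h c ∈ ds × h⁻ (h c) ≡ c) → Unique cs → length cs ≤ length ds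
  embed {cs = cs} {ds} h h⁻ inv ucs = subst (_≤ length ds) (LP.length-map h cs)
    (Unique-⊆⇒length≤
      (Unique-map⁺ ucs (λ c∈ c′∈ e → trans (sym (proj₂ (inv c∈))) (trans (cong h⁻ e) (proj₂ (inv c′∈)))))
      (λ hc∈ → let (c , c∈ , e) = ∈-map⁻ h hc∈ in subst (_∈ ds) (sym e) (proj₁ (inv c∈))))

∈-concatMap⁻′ : ∀ {A B : Set} (g : A → List B) (xs : List A) {y} → y ∈ concatMap g xs → ∃ λ x → x ∈ xs × y ∈ g x
∈-concatMap⁻′ g (x ∷ xs) y∈ with ∈-++⁻ (g x) y∈
... | inj₁ y∈gx = x , here refl , y∈gx
... | inj₂ y∈′ = let (x′ , x′∈ , y∈gx′) = ∈-concatMap⁻′ g xs y∈′ in x′ , there x′∈ , y∈gx′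

∈-concatMap⁺′ : ∀ {A B : Set} (g : A → List B) {xs : List A} {x y} → x ∈ xs → y ∈ g x → y ∈ concatMap g xs
∈-concatMap⁺′ g {x′ ∷ xs} (here refl) y∈ = ∈-++⁺ˡ y∈
∈-concatMap⁺′ g {x′ ∷ xs} (there x∈) y∈ = ∈-++⁺ʳ (g x′) (∈-concatMap⁺′ g x∈ y∈)

Unique-concatMap⁺ : ∀ {A B : Set} (g : A → List B) (key : B → A) {xs : List A} → Unique xs →
  (∀ x → x ∈ xs → Unique (g x)) → (∀ x y → y ∈ g x → key y ≡ x) → Unique (concatMap g xs)
Unique-concatMap⁺ g key {[]}     _               _     _   = AllPairs.[]
Unique-concatMap⁺ g key {x ∷ xs} (x∉xs AllPairs.∷ uniq) ublk keyed =
  UniqueP.++⁺ (ublk x (here refl)) (Unique-concatMap⁺ g key uniq (λ x′ x′∈ → ublk x′ (there x′∈)) keyed)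
    λ { (y∈gx , y∈rest) → let (x′ , x′∈ , y∈gx′) = ∈-concatMap⁻′ g xs y∈rest in
        AllP.All¬⇒¬Any x∉xs (subst (_∈ xs) (trans (sym (keyed x′ _ y∈gx′)) (keyed x _ y∈gx)) x′∈) }

-- The enumeration behind pCount

Unique-range : ∀ n → Unique (range n)
Unique-range n = UniqueP.map⁺ ℕP.suc-injective (UniqueP.upTo⁺ n)

∈-words⁻ : ∀ m n w → w ∈ words m n → length w ≡ m × LettersIn n w
∈-words⁻ zero    n .[] (here refl) = refl , []
∈-words⁻ (suc m) n w   w∈ with ∈-concatMap⁻′ (λ a → map (a ∷_) (words m n)) (range n) w∈
... | a , a∈ , w∈′ with ∈-map⁻ (a ∷_) w∈′
... | w′ , w′∈ , refl with ∈-words⁻ m n w′ w′∈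
... | len , l = cong suc len , ∈-range⁻ a∈ ∷ l

∈-words⁺ : ∀ n w → LettersIn n w → w ∈ words (length w) n
∈-words⁺ n []      []      = here refl
∈-words⁺ n (x ∷ w) (p ∷ l) =
  ∈-concatMap⁺′ (λ a → map (a ∷_) (words (length w) n)) (∈-range⁺ p) (∈-map⁺ (x ∷_) (∈-words⁺ n w l))

Unique-words : ∀ m n → Unique (words m n)
Unique-words zero    n = [] AllPairs.∷ AllPairs.[]
Unique-words (suc m) n =
  Unique-concatMap⁺ (λ a → map (a ∷_) (words m n)) firstLetter (Unique-range n)
    (λ a _ → UniqueP.map⁺ LP.∷-injectiveʳ (Unique-words m n))
    (λ a w w∈ → let (_ , _ , e) = ∈-map⁻ (a ∷_) w∈ in cong firstLetter e)
  where
  firstLetter : Word → ℕ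
  firstLetter []      = 0
  firstLetter (x ∷ _) = x

∈-tuples⁻ : ∀ k len n t → t ∈ tuples k len n → length t ≡ k × length (concat t) ≡ len × All (LettersIn n) t
∈-tuples⁻ zero    zero n   .[] (here refl) = refl , refl , []
∈-tuples⁻ (suc k) len  n t   t∈
  with ∈-concatMap⁻′ (λ m → concatMap (λ w → map (w ∷_) (tuples k (len ∸ m) n)) (words m n)) (upTo (suc len)) t∈
... | m , m∈ , t∈′ with ∈-concatMap⁻′ (λ w → map (w ∷_) (tuples k (len ∸ m) n)) (words m n) t∈′
... | w , w∈ , t∈″ with ∈-map⁻ (w ∷_) t∈″
... | t′ , t′∈ , refl with ∈-tuples⁻ k (len ∸ m) n t′ t′∈ | ∈-words⁻ m n w w∈
... | k≡ , len≡ , l | |w| , lw =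
    cong suc k≡
  , trans (LP.length-++ w) (trans (cong₂ _+_ |w| len≡) (ℕP.m+[n∸m]≡n (ℕP.≤-pred (∈-upTo⁻ m∈))))
  , lw ∷ l

∈-tuples⁺ : ∀ n t → All (LettersIn n) t → t ∈ tuples (length t) (length (concat t)) n
∈-tuples⁺ n []      []      = here refl
∈-tuples⁺ n (w ∷ t) (l ∷ ls) =
  ∈-concatMap⁺′ (λ m → concatMap (λ w′ → map (w′ ∷_) (tuples (length t) (len ∸ m) n)) (words m n))
    (∈-upTo⁺ (s≤s (subst (length w ≤_) (sym (LP.length-++ w)) (ℕP.m≤m+n _ _))))
    (∈-concatMap⁺′ (λ w′ → map (w′ ∷_) (tuples (length t) (len ∸ length w) n)) (∈-words⁺ n w l)
      (∈-map⁺ (w ∷_) (subst (λ L → t ∈ tuples (length t) L n) rest (∈-tuples⁺ n t ls))))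
  where
  len = length (concat (w ∷ t))
  rest : length (concat t) ≡ len ∸ length w
  rest = sym (trans (cong (_∸ length w) (LP.length-++ w)) (ℕP.m+n∸m≡n (length w) _))

Unique-tuples : ∀ k len n → Unique (tuples k len n)
Unique-tuples zero    zero    n = [] AllPairs.∷ AllPairs.[]
Unique-tuples zero    (suc _) n = AllPairs.[]
Unique-tuples (suc k) len     n =
  Unique-concatMap⁺ block (λ t → length (firstComponent t)) (UniqueP.upTo⁺ (suc len))
    (λ m _ → Unique-concatMap⁺ (subblock m) firstComponent (Unique-words m n)
       (λ w _ → UniqueP.map⁺ LP.∷-injectiveʳ (Unique-tuples k (len ∸ m) n))
       (λ w t t∈ → let (_ , _ , e) = ∈-map⁻ (w ∷_) t∈ in cong firstComponent e))
    (λ m t t∈ → let (w , w∈ , t∈′) = ∈-concatMap⁻′ (subblock m) (words m n) t∈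
                    (_ , _ , e) = ∈-map⁻ (w ∷_) t∈′
                in trans (cong (length ∘ firstComponent) e) (proj₁ (∈-words⁻ m n w w∈)))
  where
  subblock : ℕ → Word → List (List Word)
  subblock m w = map (w ∷_) (tuples k (len ∸ m) n)
  block : ℕ → List (List Word)
  block m = concatMap (subblock m) (words m n)
  firstComponent : List Word → Word
  firstComponent []      = []
  firstComponent (w ∷ _) = w

-- pCount r n k is definitionally length (sortableTuples r n k).
sortableTuples : ℕ → ℕ → ℕ → List (List Word)
sortableTuples r n k =
  filter (λ t → Bool._≟_ (isTupleRPermᵇ r n t ∧ twoStackSortableᵇ n t) true) (tuples k (r * n) n)

Unique-sortableTuples : ∀ r n k → Unique (sortableTuples r n k)
Unique-sortableTuples r n k = UniqueP.filter⁺ _ (Unique-tuples k (r * n) n)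

∈-sortableTuples⁻ : ∀ r n k t → t ∈ sortableTuples r n k →
                    length t ≡ k × IsTupleRPerm r n t × TwoStackSortable n t
∈-sortableTuples⁻ r n k t t∈ with ∈-filter⁻ (λ t → Bool._≟_ (isTupleRPermᵇ r n t ∧ twoStackSortableᵇ n t) true)
                                             {xs = tuples k (r * n) n} t∈
... | t∈′ , e = proj₁ (∈-tuples⁻ k (r * n) n t t∈′)
              , isTupleRPermᵇ-sound r n t (∧-trueˡ e)
              , listEqᵇ⇒≡ _ _ (∧-trueʳ {isTupleRPermᵇ r n t} e)

∈-sortableTuples⁺ : ∀ r n k t → length t ≡ k → IsTupleRPerm r n t → TwoStackSortable n t →
                    t ∈ sortableTuples r n k
∈-sortableTuples⁺ r n k t refl valid@(l , ex , _) sortable =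
  ∈-filter⁺ (λ t → Bool._≟_ (isTupleRPermᵇ r n t ∧ twoStackSortableᵇ n t) true)
    (subst (λ L → t ∈ tuples (length t) L n) (length-rperm r n (concat t) l ex) (∈-tuples⁺ n t (AllP.concat⁻ l)))
    (∧-true (isTupleRPermᵇ-complete r n t valid) (subst (λ w → listEqᵇ w (range n) ≡ true) (sym sortable) (listEqᵇ-refl (range n))))

-- Splitting a word at a letter and joining it back

joinOnLetter : ℕ → List Word → Word
joinOnLetter m []            = []
joinOnLetter m (β ∷ [])      = β
joinOnLetter m (β ∷ β′ ∷ βs) = β ++ m ∷ joinOnLetter m (β′ ∷ βs)

-- Stated for a nonempty list β ∷ γs so that the recursion is on γs.
∈-joinOnLetter⁻ : ∀ m β γs {a} → a ∈ joinOnLetter m (β ∷ γs) → a ≡ m ⊎ a ∈ concat (β ∷ γs)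
∈-joinOnLetter⁻ m β []        a∈ = inj₂ (∈-++⁺ˡ a∈)
∈-joinOnLetter⁻ m β (β′ ∷ βs) a∈ with ∈-++⁻ β a∈
... | inj₁ a∈β         = inj₂ (∈-++⁺ˡ a∈β)
... | inj₂ (here a≡m)  = inj₁ a≡m
... | inj₂ (there a∈′) = map₂ (∈-++⁺ʳ β) (∈-joinOnLetter⁻ m β′ βs a∈′)

∈-joinOnLetter⁺ : ∀ m β γs {a} → a ∈ concat (β ∷ γs) → a ∈ joinOnLetter m (β ∷ γs)
∈-joinOnLetter⁺ m β []        a∈ = subst (_ ∈_) (LP.++-identityʳ β) a∈
∈-joinOnLetter⁺ m β (β′ ∷ βs) a∈ with ∈-++⁻ β a∈
... | inj₁ a∈β  = ∈-++⁺ˡ a∈β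
... | inj₂ a∈βs = ∈-++⁺ʳ β (there (∈-joinOnLetter⁺ m β′ βs a∈βs))

letter∈joinOnLetter : ∀ m β β′ βs → m ∈ joinOnLetter m (β ∷ β′ ∷ βs)
letter∈joinOnLetter m β β′ βs = ∈-++⁺ʳ β (here refl)

occ-joinOnLetter : ∀ a m β γs → a ≢ m → occ a (joinOnLetter m (β ∷ γs)) ≡ occ a (concat (β ∷ γs))
occ-joinOnLetter a m β []        a≢m = cong (occ a) (sym (LP.++-identityʳ β))
occ-joinOnLetter a m β (β′ ∷ βs) a≢m
  rewrite occ-++ a β (m ∷ joinOnLetter m (β′ ∷ βs)) | occ-++ a β (concat (β′ ∷ βs)) | ≢⇒≡ᵇ-false a≢m =
  cong (occ a β +_) (occ-joinOnLetter a m β′ βs a≢m)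

occ-letter-joinOnLetter : ∀ m β γs → m ∉ concat (β ∷ γs) → occ m (joinOnLetter m (β ∷ γs)) ≡ length γs
occ-letter-joinOnLetter m β []        m∉ = ∉⇒occ≡0 m β (m∉ ∘ ∈-++⁺ˡ)
occ-letter-joinOnLetter m β (β′ ∷ βs) m∉
  rewrite occ-++ m β (m ∷ joinOnLetter m (β′ ∷ βs)) | ∉⇒occ≡0 m β (m∉ ∘ ∈-++⁺ˡ) | ≡⇒≡ᵇ-true {m} refl =
  cong suc (occ-letter-joinOnLetter m β′ βs (m∉ ∘ ∈-++⁺ʳ β))

splitOnLetter-nonempty : ∀ m w → ∃₂ λ β βs → splitOnLetter m w ≡ β ∷ βs
splitOnLetter-nonempty m []      = [] , [] , refl
splitOnLetter-nonempty m (x ∷ w) with x ≡ᵇ m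
... | true  = [] , splitOnLetter m w , refl
... | false with splitOnLetter-nonempty m w
...   | β , βs , e rewrite e = x ∷ β , βs , refl

splitOnLetter-++ : ∀ m α w β βs → m ∉ α → splitOnLetter m w ≡ β ∷ βs → splitOnLetter m (α ++ w) ≡ (α ++ β) ∷ βs
splitOnLetter-++ m []      w β βs m∉ e = e
splitOnLetter-++ m (x ∷ α) w β βs m∉ e with x ≡ᵇ m in eq
... | true  = ⊥-elim (m∉ (here (sym (≡ᵇ-true⇒≡ eq))))
... | false rewrite splitOnLetter-++ m α w β βs (m∉ ∘ there) e = refl

splitOnLetter-joinOnLetter : ∀ m β βs → m ∉ concat (β ∷ βs) → splitOnLetter m (joinOnLetter m (β ∷ βs)) ≡ β ∷ βs
splitOnLetter-joinOnLetter m β [] m∉ = begin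
    splitOnLetter m β
  ≡⟨ cong (splitOnLetter m) (sym (LP.++-identityʳ β)) ⟩
    splitOnLetter m (β ++ [])
  ≡⟨ splitOnLetter-++ m β [] [] [] (m∉ ∘ ∈-++⁺ˡ) refl ⟩
    (β ++ []) ∷ []
  ≡⟨ cong (_∷ []) (LP.++-identityʳ β) ⟩
    β ∷ []
  ∎
splitOnLetter-joinOnLetter m β (β′ ∷ βs) m∉ = begin
    splitOnLetter m (β ++ m ∷ joinOnLetter m (β′ ∷ βs))
  ≡⟨ splitOnLetter-++ m β _ [] (β′ ∷ βs) (m∉ ∘ ∈-++⁺ˡ) rest ⟩
    (β ++ []) ∷ β′ ∷ βs
  ≡⟨ cong (_∷ β′ ∷ βs) (LP.++-identityʳ β) ⟩
    β ∷ β′ ∷ βs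
  ∎
  where
  rest : splitOnLetter m (m ∷ joinOnLetter m (β′ ∷ βs)) ≡ [] ∷ β′ ∷ βs
  rest rewrite ≡⇒≡ᵇ-true {m} refl = cong ([] ∷_) (splitOnLetter-joinOnLetter m β′ βs (m∉ ∘ ∈-++⁺ʳ β))

joinOnLetter-splitOnLetter : ∀ m w → joinOnLetter m (splitOnLetter m w) ≡ w
joinOnLetter-splitOnLetter m []      = refl
joinOnLetter-splitOnLetter m (x ∷ w) with x ≡ᵇ m in eq | splitOnLetter-nonempty m w
... | true  | β , βs , e rewrite ≡ᵇ-true⇒≡ {x} {m} eq | e =
  cong (m ∷_) (trans (cong (joinOnLetter m) (sym e)) (joinOnLetter-splitOnLetter m w))
... | false | β , βs , e = trans (consHead-join (splitOnLetter m w) e) (cong (x ∷_) (joinOnLetter-splitOnLetter m w))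
  where
  consHead-join : ∀ ws → ws ≡ β ∷ βs → joinOnLetter m (consHead x ws) ≡ x ∷ joinOnLetter m ws
  consHead-join (_ ∷ [])     _ = refl
  consHead-join (_ ∷ _ ∷ _)  _ = refl

∈-piece⇒∈ : ∀ m w {p a} → p ∈ splitOnLetter m w → a ∈ p → a ∈ w
∈-piece⇒∈ m w p∈ a∈ with splitOnLetter m w | joinOnLetter-splitOnLetter m w
... | β ∷ γs | join≡w = subst (_ ∈_) join≡w (∈-joinOnLetter⁺ m β γs (∈-concat⁺′ a∈ p∈))

∈⇒∈-pieces : ∀ m w {a} → a ∈ w → a ≡ m ⊎ a ∈ concat (splitOnLetter m w)
∈⇒∈-pieces m w a∈ with splitOnLetter m w | joinOnLetter-splitOnLetter m w
... | []     | refl   = case a∈ of λ ()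
... | β ∷ γs | join≡w = ∈-joinOnLetter⁻ m β γs (subst (_ ∈_) (sym join≡w) a∈)

letter∉piece : ∀ m w {p} → p ∈ splitOnLetter m w → m ∉ p
letter∉piece m []      (here refl) ()
letter∉piece m (x ∷ w) {p} p∈ m∈ with x ≡ᵇ m in eq
... | true with p∈
...   | here refl  = case m∈ of λ ()
...   | there p∈′  = letter∉piece m w p∈′ m∈
letter∉piece m (x ∷ w) {p} p∈ m∈ | false with splitOnLetter-nonempty m w
... | β , βs , e rewrite e with p∈
...   | there p∈′ = letter∉piece m w (subst (p ∈_) (sym e) (there p∈′)) m∈
...   | here refl with m∈
...     | here refl  = false≢true (trans (sym eq) (≡⇒≡ᵇ-true {x} refl))
...     | there m∈′  = letter∉piece m w (subst (β ∈_) (sym e) (here refl)) m∈′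

length-piece≤ : ∀ m w {p} → p ∈ splitOnLetter m w → length p ≤ length w
length-piece≤ m []      (here refl) = z≤n
length-piece≤ m (x ∷ w) {p} p∈ with x ≡ᵇ m
... | true with p∈
...   | here refl = z≤n
...   | there p∈′ = ℕP.m≤n⇒m≤1+n (length-piece≤ m w p∈′)
length-piece≤ m (x ∷ w) {p} p∈ | false with splitOnLetter-nonempty m w
... | β , βs , e rewrite e with p∈
...   | here refl = s≤s (length-piece≤ m w (subst (β ∈_) (sym e) (here refl)))
...   | there p∈′ = ℕP.m≤n⇒m≤1+n (length-piece≤ m w (subst (p ∈_) (sym e) (there p∈′)))

length-piece< : ∀ m w {p} → p ∈ splitOnLetter m w → m ∈ w → length p < length w
length-piece< m (x ∷ w) {p} p∈ m∈ with x ≡ᵇ m in eq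
... | true with p∈
...   | here refl = s≤s z≤n
...   | there p∈′ = s≤s (length-piece≤ m w p∈′)
length-piece< m (x ∷ w) {p} p∈ m∈ | false with splitOnLetter-nonempty m w
... | β , βs , e rewrite e with m∈
...   | here refl = ⊥-elim (false≢true (trans (sym eq) (≡⇒≡ᵇ-true {x} refl)))
...   | there m∈′ with p∈
...     | here refl = s≤s (length-piece< m w (subst (β ∈_) (sym e) (here refl)) m∈′)
...     | there p∈′ = s≤s (length-piece≤ m w (subst (p ∈_) (sym e) (there p∈′)))

length-splitOnLetter : ∀ m w → length (splitOnLetter m w) ≡ suc (occ m w)
length-splitOnLetter m []      = refl
length-splitOnLetter m (x ∷ w) rewrite ≡ᵇ-sym x m with m ≡ᵇ x
... | true  = cong suc (length-splitOnLetter m w)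
... | false with splitOnLetter-nonempty m w
...   | β , βs , e rewrite e = trans (cong length (sym e)) (length-splitOnLetter m w)

-- Stack sorting

maxL-upper : ∀ {a} w → a ∈ w → a ≤ maxL w
maxL-upper (x ∷ w) (here refl) = ℕP.m≤m⊔n x (maxL w)
maxL-upper (x ∷ w) (there a∈)  = ℕP.≤-trans (maxL-upper w a∈) (ℕP.m≤n⊔m x (maxL w))

maxL-least : ∀ {m} w → All (_≤ m) w → maxL w ≤ m
maxL-least []      []       = z≤n
maxL-least (x ∷ w) (p ∷ ps) = ℕP.⊔-lub p (maxL-least w ps)

maxL-∈ : ∀ x w → maxL (x ∷ w) ∈ x ∷ w
maxL-∈ x []      rewrite ℕP.⊔-identityʳ x = here refl
maxL-∈ x (y ∷ w) with ℕP.⊔-sel x (maxL (y ∷ w))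
... | inj₁ e = here e
... | inj₂ e = there (subst (_∈ y ∷ w) (sym e) (maxL-∈ y w))

maxL-≡ : ∀ {m} w → m ∈ w → All (_≤ m) w → maxL w ≡ m
maxL-≡ w m∈ ≤m = ℕP.≤-antisym (maxL-least w ≤m) (maxL-upper w m∈)

stackSortF-[] : ∀ f → stackSortF f [] ≡ []
stackSortF-[] zero    = refl
stackSortF-[] (suc f) = refl

-- Each piece is shorter than the word, so any fuel ≥ length suffices.
stackSortF-fuel : ∀ f g w → length w ≤ f → length w ≤ g → stackSortF f w ≡ stackSortF g w
stackSortF-fuel f       g       []      _        _        = trans (stackSortF-[] f) (sym (stackSortF-[] g))
stackSortF-fuel (suc f) (suc g) (x ∷ w) (s≤s w≤f) (s≤s w≤g) =
  cong (λ ws → concat ws ++ [ maxL (x ∷ w) ]) (LP.map-cong-local (All.tabulate λ {p} p∈ →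
    let p< = ℕP.≤-pred (length-piece< (maxL (x ∷ w)) (x ∷ w) p∈ (maxL-∈ x w)) in
    stackSortF-fuel f g p (ℕP.≤-trans p< w≤f) (ℕP.≤-trans p< w≤g)))

S-∷ : ∀ x w → S (x ∷ w) ≡ concat (map S (splitOnLetter (maxL (x ∷ w)) (x ∷ w))) ++ [ maxL (x ∷ w) ]
S-∷ x w = cong (λ ws → concat ws ++ [ maxL (x ∷ w) ]) (LP.map-cong-local (All.tabulate λ {p} p∈ →
  stackSortF-fuel (length w) (length p) p (ℕP.≤-pred (length-piece< (maxL (x ∷ w)) (x ∷ w) p∈ (maxL-∈ x w))) ℕP.≤-refl))

∈-stackSortF⁻ : ∀ f w {a} → length w ≤ f → a ∈ stackSortF f w → a ∈ w
∈-stackSortF⁻ (suc f) (x ∷ w) (s≤s w≤f) a∈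
  with ∈-++⁻ (concat (map (stackSortF f) (splitOnLetter (maxL (x ∷ w)) (x ∷ w)))) a∈
... | inj₂ (here refl) = maxL-∈ x w
... | inj₁ a∈′ with ∈-concat⁻′ _ a∈′
...   | _ , a∈s , s∈ with ∈-map⁻ (stackSortF f) s∈
...     | p , p∈ , refl = ∈-piece⇒∈ (maxL (x ∷ w)) (x ∷ w) p∈
          (∈-stackSortF⁻ f p (ℕP.≤-trans (ℕP.≤-pred (length-piece< _ _ p∈ (maxL-∈ x w))) w≤f) a∈s)

∈-stackSortF⁺ : ∀ f w {a} → length w ≤ f → a ∈ w → a ∈ stackSortF f w
∈-stackSortF⁺ (suc f) (x ∷ w) (s≤s w≤f) a∈ with ∈⇒∈-pieces (maxL (x ∷ w)) (x ∷ w) a∈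
... | inj₁ refl = ∈-++⁺ʳ (concat (map (stackSortF f) (splitOnLetter (maxL (x ∷ w)) (x ∷ w)))) (here refl)
... | inj₂ a∈′ with ∈-concat⁻′ _ a∈′
...   | p , a∈p , p∈ = ∈-++⁺ˡ (∈-concat⁺′
          (∈-stackSortF⁺ f p (ℕP.≤-trans (ℕP.≤-pred (length-piece< _ _ p∈ (maxL-∈ x w))) w≤f) a∈p)
          (∈-map⁺ (stackSortF f) p∈))

∈-S⁻ : ∀ w {a} → a ∈ S w → a ∈ w
∈-S⁻ w = ∈-stackSortF⁻ (length w) w ℕP.≤-refl

∈-S⁺ : ∀ w {a} → a ∈ w → a ∈ S w
∈-S⁺ w = ∈-stackSortF⁺ (length w) w ℕP.≤-refl

S-maxL : ∀ m w → m ∈ w → maxL w ≡ m → S w ≡ concat (map S (splitOnLetter m w)) ++ [ m ]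
S-maxL m (x ∷ w) _ refl = S-∷ x w

S-joinOnLetter : ∀ m β β′ βs → m ∉ concat (β ∷ β′ ∷ βs) → All (_≤ m) (concat (β ∷ β′ ∷ βs)) →
                 S (joinOnLetter m (β ∷ β′ ∷ βs)) ≡ concat (map S (β ∷ β′ ∷ βs)) ++ [ m ]
S-joinOnLetter m β β′ βs m∉ ≤m = begin
    S joined
  ≡⟨ S-maxL m joined m∈ (maxL-≡ joined m∈ (All.tabulate (≤m′ ∘ ∈-joinOnLetter⁻ m β (β′ ∷ βs)))) ⟩
    concat (map S (splitOnLetter m joined)) ++ [ m ]
  ≡⟨ cong (λ βs′ → concat (map S βs′) ++ [ m ]) (splitOnLetter-joinOnLetter m β (β′ ∷ βs) m∉) ⟩
    concat (map S (β ∷ β′ ∷ βs)) ++ [ m ]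
  ∎
  where
  joined = joinOnLetter m (β ∷ β′ ∷ βs)
  m∈ = letter∈joinOnLetter m β β′ βs
  ≤m′ : ∀ {a} → a ≡ m ⊎ a ∈ concat (β ∷ β′ ∷ βs) → a ≤ m
  ≤m′ (inj₁ refl) = ℕP.≤-refl
  ≤m′ (inj₂ a∈)   = All.lookup ≤m a∈

-- Shifting letters

≡ᵇ-+ˡ : ∀ i x m → (i + x ≡ᵇ i + m) ≡ (x ≡ᵇ m)
≡ᵇ-+ˡ zero    x m = refl
≡ᵇ-+ˡ (suc i) x m = ≡ᵇ-+ˡ i x m

∈-shift⁻ : ∀ i x w → i + x ∈ map (i +_) w → x ∈ w
∈-shift⁻ i x w ix∈ with ∈-map⁻ (i +_) ix∈
... | y , y∈ , e rewrite ℕP.+-cancelˡ-≡ i x y e = y∈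

occ-shift : ∀ i a w → occ (i + a) (map (i +_) w) ≡ occ a w
occ-shift i a []      = refl
occ-shift i a (x ∷ w) rewrite ≡ᵇ-+ˡ i a x with a ≡ᵇ x
... | true  = cong suc (occ-shift i a w)
... | false = occ-shift i a w

maxL-shift : ∀ i x w → maxL (map (i +_) (x ∷ w)) ≡ i + maxL (x ∷ w)
maxL-shift i x []      = trans (ℕP.⊔-identityʳ (i + x)) (cong (i +_) (sym (ℕP.⊔-identityʳ x)))
maxL-shift i x (y ∷ w) =
  trans (cong ((i + x) ⊔_) (maxL-shift i y w)) (sym (ℕP.+-distribˡ-⊔ i x (maxL (y ∷ w))))

splitOnLetter-shift : ∀ i m w → splitOnLetter (i + m) (map (i +_) w) ≡ map (map (i +_)) (splitOnLetter m w)
splitOnLetter-shift i m []      = refl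
splitOnLetter-shift i m (x ∷ w) rewrite ≡ᵇ-+ˡ i x m with x ≡ᵇ m
... | true  = cong ([] ∷_) (splitOnLetter-shift i m w)
... | false = trans (cong (consHead (i + x)) (splitOnLetter-shift i m w)) (consHead-shift (splitOnLetter m w))
  where
  consHead-shift : ∀ ws → consHead (i + x) (map (map (i +_)) ws) ≡ map (map (i +_)) (consHead x ws)
  consHead-shift []      = refl
  consHead-shift (_ ∷ _) = refl

stackSortF-shift : ∀ i f w → length w ≤ f → stackSortF f (map (i +_) w) ≡ map (i +_) (stackSortF f w)
stackSortF-shift i f       []      _         = trans (stackSortF-[] f) (sym (cong (map (i +_)) (stackSortF-[] f)))
stackSortF-shift i (suc f) (x ∷ w) (s≤s w≤f) = begin
    concat (map (stackSortF f) (splitOnLetter (maxL (map (i +_) (x ∷ w))) (map (i +_) (x ∷ w))))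
      ++ [ maxL (map (i +_) (x ∷ w)) ]
  ≡⟨ cong (λ z → concat (map (stackSortF f) (splitOnLetter z (map (i +_) (x ∷ w)))) ++ [ z ]) (maxL-shift i x w) ⟩
    concat (map (stackSortF f) (splitOnLetter (i + M) (map (i +_) (x ∷ w)))) ++ [ i + M ]
  ≡⟨ cong (λ ps → concat (map (stackSortF f) ps) ++ [ i + M ]) (splitOnLetter-shift i M (x ∷ w)) ⟩
    concat (map (stackSortF f) (map (map (i +_)) ps)) ++ [ i + M ]
  ≡⟨ cong (λ z → concat z ++ [ i + M ]) (sym (LP.map-∘ ps)) ⟩
    concat (map (stackSortF f ∘ map (i +_)) ps) ++ [ i + M ]
  ≡⟨ cong (λ z → concat z ++ [ i + M ]) (LP.map-cong-local (All.tabulate λ {p} p∈ →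
       stackSortF-shift i f p (ℕP.≤-trans (ℕP.≤-pred (length-piece< M (x ∷ w) p∈ (maxL-∈ x w))) w≤f))) ⟩
    concat (map (map (i +_) ∘ stackSortF f) ps) ++ [ i + M ]
  ≡⟨ cong (λ z → concat z ++ [ i + M ]) (LP.map-∘ ps) ⟩
    concat (map (map (i +_)) (map (stackSortF f) ps)) ++ [ i + M ]
  ≡⟨ cong (_++ [ i + M ]) (LP.concat-map (map (stackSortF f) ps)) ⟩
    map (i +_) (concat (map (stackSortF f) ps)) ++ [ i + M ]
  ≡⟨ sym (LP.map-++ (i +_) (concat (map (stackSortF f) ps)) [ M ]) ⟩
    map (i +_) (concat (map (stackSortF f) ps) ++ [ M ])
  ∎
  where
  M  = maxL (x ∷ w)
  ps = splitOnLetter M (x ∷ w)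

S-shift : ∀ i w → S (map (i +_) w) ≡ map (i +_) (S w)
S-shift i w rewrite LP.length-map (i +_) w = stackSortF-shift i (length w) w ℕP.≤-refl

sortEach : List Word → Word
sortEach t = concat (map S t)

sortEach-++ : ∀ t u → sortEach (t ++ u) ≡ sortEach t ++ sortEach u
sortEach-++ t u = trans (cong concat (LP.map-++ S t u)) (sym (LP.concat-++ (map S t) (map S u)))

∈-sortEach⁻ : ∀ t {a} → a ∈ sortEach t → a ∈ concat t
∈-sortEach⁻ (w ∷ t) a∈ with ∈-++⁻ (S w) a∈
... | inj₁ a∈w = ∈-++⁺ˡ (∈-S⁻ w a∈w)
... | inj₂ a∈t = ∈-++⁺ʳ w (∈-sortEach⁻ t a∈t)

∈-sortEach⁺ : ∀ t {a} → a ∈ concat t → a ∈ sortEach t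
∈-sortEach⁺ (w ∷ t) a∈ with ∈-++⁻ w a∈
... | inj₁ a∈w = ∈-++⁺ˡ (∈-S⁺ w a∈w)
... | inj₂ a∈t = ∈-++⁺ʳ (S w) (∈-sortEach⁺ t a∈t)

sortEach-shift : ∀ i t → sortEach (map (map (i +_)) t) ≡ map (i +_) (sortEach t)
sortEach-shift i t =
  trans (cong concat (trans (sym (LP.map-∘ t)) (trans (LP.map-cong (S-shift i) t) (LP.map-∘ t))))
        (LP.concat-map (map S t))

range-suc : ∀ n → range (suc n) ≡ range n ++ [ suc n ]
range-suc n = trans (cong (map suc) (sym (LP.upTo-∷ʳ n))) (LP.map-++ suc (upTo n) [ n ])

range-+ : ∀ i a → range (i + a) ≡ range i ++ map (i +_) (range a)
range-+ i zero rewrite ℕP.+-identityʳ i = sym (LP.++-identityʳ (range i))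
range-+ i (suc a) = begin
    range (i + suc a)
  ≡⟨ cong range (ℕP.+-suc i a) ⟩
    range (suc (i + a))
  ≡⟨ range-suc (i + a) ⟩
    range (i + a) ++ [ suc (i + a) ]
  ≡⟨ cong₂ _++_ (range-+ i a) (cong [_] (sym (ℕP.+-suc i a))) ⟩
    (range i ++ map (i +_) (range a)) ++ [ i + suc a ]
  ≡⟨ LP.++-assoc (range i) _ _ ⟩
    range i ++ (map (i +_) (range a) ++ map (i +_) [ suc a ])
  ≡⟨ cong (range i ++_) (sym (LP.map-++ (i +_) (range a) [ suc a ])) ⟩
    range i ++ map (i +_) (range a ++ [ suc a ])
  ≡⟨ cong (λ z → range i ++ map (i +_) z) (sym (range-suc a)) ⟩
    range i ++ map (i +_) (range (suc a))
  ∎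

length-range : ∀ n → length (range n) ≡ n
length-range n = trans (LP.length-map suc (upTo n)) (LP.length-upTo n)

S-sortEach-split : ∀ m A β β′ βs B → m ∉ concat (A ++ β ∷ β′ ∷ βs) → m ∉ concat B →
  All (_≤ m) (concat (A ++ β ∷ β′ ∷ βs)) → All (_≤ m) (concat B) →
  S (sortEach (A ++ joinOnLetter m (β ∷ β′ ∷ βs) ∷ B)) ≡ S (sortEach (A ++ β ∷ β′ ∷ βs)) ++ S (sortEach B) ++ [ m ]
S-sortEach-split m A β β′ βs B m∉L m∉B ≤mL ≤mB = begin
    S (sortEach (A ++ G ∷ B))
  ≡⟨ cong S sortEach≡ ⟩
    S (joinOnLetter m (X ∷ sortEach B ∷ []))
  ≡⟨ S-joinOnLetter m X (sortEach B) [] m∉XB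
       (AllP.++⁺ (All.tabulate λ a∈ → All.lookup ≤mL (∈-sortEach⁻ L a∈))
                 (AllP.++⁺ (All.tabulate λ a∈ → All.lookup ≤mB (∈-sortEach⁻ B a∈)) [])) ⟩
    (S X ++ S (sortEach B) ++ []) ++ [ m ]
  ≡⟨ cong (λ z → (S X ++ z) ++ [ m ]) (LP.++-identityʳ (S (sortEach B))) ⟩
    (S X ++ S (sortEach B)) ++ [ m ]
  ≡⟨ LP.++-assoc (S X) (S (sortEach B)) [ m ] ⟩
    S X ++ S (sortEach B) ++ [ m ]
  ∎
  where
  βs₀ = β ∷ β′ ∷ βs
  G   = joinOnLetter m βs₀
  L   = A ++ βs₀
  X   = sortEach L
  βs⊆L : ∀ {a} → a ∈ concat βs₀ → a ∈ concat L
  βs⊆L a∈ = subst (_ ∈_) (LP.concat-++ A βs₀) (∈-++⁺ʳ (concat A) a∈)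
  m∉XB : m ∉ concat (X ∷ sortEach B ∷ [])
  m∉XB m∈ with ∈-++⁻ X m∈
  ... | inj₁ m∈X = m∉L (∈-sortEach⁻ L m∈X)
  ... | inj₂ m∈B = m∉B (∈-sortEach⁻ B (subst (_ ∈_) (LP.++-identityʳ (sortEach B)) m∈B))
  sortEach≡ : sortEach (A ++ G ∷ B) ≡ joinOnLetter m (X ∷ sortEach B ∷ [])
  sortEach≡ = begin
      sortEach (A ++ G ∷ B)
    ≡⟨ sortEach-++ A (G ∷ B) ⟩
      sortEach A ++ S G ++ sortEach B
    ≡⟨ cong (λ z → sortEach A ++ z ++ sortEach B)
         (S-joinOnLetter m β β′ βs (m∉L ∘ βs⊆L) (All.tabulate (All.lookup ≤mL ∘ βs⊆L))) ⟩
      sortEach A ++ (sortEach βs₀ ++ [ m ]) ++ sortEach B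
    ≡⟨ cong (sortEach A ++_) (LP.++-assoc (sortEach βs₀) [ m ] (sortEach B)) ⟩
      sortEach A ++ (sortEach βs₀ ++ m ∷ sortEach B)
    ≡⟨ sym (LP.++-assoc (sortEach A) (sortEach βs₀) (m ∷ sortEach B)) ⟩
      (sortEach A ++ sortEach βs₀) ++ m ∷ sortEach B
    ≡⟨ cong (_++ m ∷ sortEach B) (sym (sortEach-++ A βs₀)) ⟩
      X ++ m ∷ sortEach B
    ∎

-- Nestedness under concatenation, shifting and deletion

CappedBy-++⁻ˡ : ∀ x u v → CappedBy x (u ++ v) → CappedBy x u
CappedBy-++⁻ˡ x []      v c        = tt
CappedBy-++⁻ˡ x (y ∷ u) v (c , cs) = c ∘ ∈-++⁺ˡ , CappedBy-++⁻ˡ x u v cs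

CappedBy-++⁻ʳ : ∀ x u v → CappedBy x (u ++ v) → CappedBy x v
CappedBy-++⁻ʳ x []      v c        = c
CappedBy-++⁻ʳ x (y ∷ u) v (c , cs) = CappedBy-++⁻ʳ x u v cs

∉⇒CappedBy : ∀ x w → x ∉ w → CappedBy x w
∉⇒CappedBy x []      x∉ = tt
∉⇒CappedBy x (y ∷ w) x∉ = (λ x∈ → ⊥-elim (x∉ (there x∈))) , ∉⇒CappedBy x w (x∉ ∘ there)

CappedBy-++⁺ : ∀ x u v → x ∉ v → CappedBy x u → CappedBy x (u ++ v)
CappedBy-++⁺ x []      v x∉ c        = ∉⇒CappedBy x v x∉
CappedBy-++⁺ x (y ∷ u) v x∉ (c , cs) =
  (λ x∈ → c ([ id , ⊥-elim ∘ x∉ ]′ (∈-++⁻ u x∈))) , CappedBy-++⁺ x u v x∉ cs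

All≤⇒CappedBy : ∀ x w → All (_≤ x) w → CappedBy x w
All≤⇒CappedBy x []      []       = tt
All≤⇒CappedBy x (y ∷ w) (p ∷ ps) = (λ _ → p) , All≤⇒CappedBy x w ps

Nested-++⁻ˡ : ∀ u v → Nested (u ++ v) → Nested u
Nested-++⁻ˡ []      v p       = tt
Nested-++⁻ˡ (x ∷ u) v (c , p) = CappedBy-++⁻ˡ x u v c , Nested-++⁻ˡ u v p

Nested-++⁻ʳ : ∀ u v → Nested (u ++ v) → Nested v
Nested-++⁻ʳ []      v p       = p
Nested-++⁻ʳ (x ∷ u) v (c , p) = Nested-++⁻ʳ u v p

Nested-++⁺ : ∀ u v → (∀ {x} → x ∈ u → x ∉ v) → Nested u → Nested v → Nested (u ++ v)
Nested-++⁺ []      v disj pu       pv = pv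
Nested-++⁺ (x ∷ u) v disj (c , pu) pv = CappedBy-++⁺ x u v (disj (here refl)) c , Nested-++⁺ u v (disj ∘ there) pu pv

Nested-++⇒CappedBy : ∀ u v {a} → Nested (u ++ v) → a ∈ u → CappedBy a v
Nested-++⇒CappedBy (x ∷ u) v (c , p) (here refl) = CappedBy-++⁻ʳ x u v c
Nested-++⇒CappedBy (x ∷ u) v (c , p) (there a∈) = Nested-++⇒CappedBy u v p a∈

Nested-shift⁺ : ∀ i w → Nested w → Nested (map (i +_) w)
Nested-shift⁺ i []      p       = tt
Nested-shift⁺ i (x ∷ w) (c , p) = capped w c , Nested-shift⁺ i w p
  where
  capped : ∀ v → CappedBy x v → CappedBy (i + x) (map (i +_) v)
  capped []      c        = tt
  capped (y ∷ v) (c , cs) = (λ ix∈ → ℕP.+-monoʳ-≤ i (c (∈-shift⁻ i x v ix∈))) , capped v cs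

Nested-shift⁻ : ∀ i w → Nested (map (i +_) w) → Nested w
Nested-shift⁻ i []      p       = tt
Nested-shift⁻ i (x ∷ w) (c , p) = capped w c , Nested-shift⁻ i w p
  where
  capped : ∀ v → CappedBy (i + x) (map (i +_) v) → CappedBy x v
  capped []      c        = tt
  capped (y ∷ v) (c , cs) = (λ x∈ → ℕP.+-cancelˡ-≤ i y x (c (∈-map⁺ (i +_) x∈))) , capped v cs

Nested-deleteAll : ∀ a w → Nested w → Nested (deleteAll a w)
Nested-deleteAll a []      p       = tt
Nested-deleteAll a (x ∷ w) (c , p) with a ≡ᵇ x
... | true  = Nested-deleteAll a w p
... | false = capped w c , Nested-deleteAll a w p
  where
  capped : ∀ v → CappedBy x v → CappedBy x (deleteAll a v)
  capped []      c        = tt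
  capped (y ∷ v) (c , cs) with a ≡ᵇ y
  ... | true  = capped v cs
  ... | false = c ∘ proj₁ ∘ ∈-filter⁻ (λ z → ¬? (a ≟ z)) {xs = v} , capped v cs

deleteAll-++ : ∀ a u v → deleteAll a (u ++ v) ≡ deleteAll a u ++ deleteAll a v
deleteAll-++ a []      v = refl
deleteAll-++ a (x ∷ u) v with a ≡ᵇ x
... | true  = deleteAll-++ a u v
... | false = cong (x ∷_) (deleteAll-++ a u v)

deleteAll-∉ : ∀ a w → a ∉ w → deleteAll a w ≡ w
deleteAll-∉ a []      a∉ = refl
deleteAll-∉ a (x ∷ w) a∉ with a ≡ᵇ x in eq
... | true  = ⊥-elim (a∉ (here (≡ᵇ-true⇒≡ eq)))
... | false = cong (x ∷_) (deleteAll-∉ a w (a∉ ∘ there))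

deleteAll-joinOnLetter : ∀ m β γs → m ∉ concat (β ∷ γs) → deleteAll m (joinOnLetter m (β ∷ γs)) ≡ concat (β ∷ γs)
deleteAll-joinOnLetter m β []        m∉ = trans (deleteAll-∉ m β (m∉ ∘ ∈-++⁺ˡ)) (sym (LP.++-identityʳ β))
deleteAll-joinOnLetter m β (β′ ∷ βs) m∉ rewrite deleteAll-++ m β (m ∷ joinOnLetter m (β′ ∷ βs)) | ≡⇒≡ᵇ-true {m} refl =
  cong₂ _++_ (deleteAll-∉ m β (m∉ ∘ ∈-++⁺ˡ)) (deleteAll-joinOnLetter m β′ βs (m∉ ∘ ∈-++⁺ʳ β))

Disjointᵗ-++⁻ : ∀ t u → Disjointᵗ (t ++ u) → Disjointᵗ t × Disjointᵗ u × (∀ {a} → a ∈ concat t → a ∉ concat u)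
Disjointᵗ-++⁻ []      u d        = tt , d , λ ()
Disjointᵗ-++⁻ (w ∷ t) u (d , ds) with Disjointᵗ-++⁻ t u ds
... | dt , du , sep =
    ((λ a a∈w a∈t → d a a∈w (subst (a ∈_) (LP.concat-++ t u) (∈-++⁺ˡ a∈t))) , dt)
  , du
  , λ {a} a∈ a∈u → [ (λ a∈w → d a a∈w (subst (a ∈_) (LP.concat-++ t u) (∈-++⁺ʳ (concat t) a∈u)))
                           , (λ a∈t → sep a∈t a∈u) ]′ (∈-++⁻ w a∈)

Disjointᵗ-++⁺ : ∀ t u → Disjointᵗ t → Disjointᵗ u → (∀ {a} → a ∈ concat t → a ∉ concat u) → Disjointᵗ (t ++ u)
Disjointᵗ-++⁺ []      u dt       du sep = du
Disjointᵗ-++⁺ (w ∷ t) u (d , dt) du sep =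
    (λ a a∈w a∈tu → [ d a a∈w , sep (∈-++⁺ˡ a∈w) ]′ (∈-++⁻ (concat t) (subst (a ∈_) (sym (LP.concat-++ t u)) a∈tu)))
  , Disjointᵗ-++⁺ t u dt du (sep ∘ ∈-++⁺ʳ w)

Disjointᵗ-shift⁺ : ∀ i t → Disjointᵗ t → Disjointᵗ (map (map (i +_)) t)
Disjointᵗ-shift⁺ i []      d        = tt
Disjointᵗ-shift⁺ i (w ∷ t) (d , ds) = disj , Disjointᵗ-shift⁺ i t ds
  where
  disj : ∀ a → a ∈ map (i +_) w → a ∉ concat (map (map (i +_)) t)
  disj a a∈ a∈t with ∈-map⁻ (i +_) a∈
  ... | b , b∈ , refl = d b b∈ (∈-shift⁻ i b (concat t) (subst (i + b ∈_) (LP.concat-map t) a∈t))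

Disjointᵗ-shift⁻ : ∀ i t → Disjointᵗ (map (map (i +_)) t) → Disjointᵗ t
Disjointᵗ-shift⁻ i []      d        = tt
Disjointᵗ-shift⁻ i (w ∷ t) (d , ds) =
    (λ a a∈w a∈t → d (i + a) (∈-map⁺ (i +_) a∈w) (subst (i + a ∈_) (sym (LP.concat-map t)) (∈-map⁺ (i +_) a∈t)))
  , Disjointᵗ-shift⁻ i t ds

Nested-joinOnLetter : ∀ m β γs → Nested (concat (β ∷ γs)) → Disjointᵗ (β ∷ γs) → All (_< m) (concat (β ∷ γs)) →
                      Nested (joinOnLetter m (β ∷ γs))
Nested-joinOnLetter m β []        p d <m = Nested-++⁻ˡ β [] p
Nested-joinOnLetter m β (β′ ∷ βs) p (d , ds) <m =
  Nested-++⁺ β (m ∷ joinOnLetter m (β′ ∷ βs)) apart (Nested-++⁻ˡ β (concat (β′ ∷ βs)) p)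
    ( All≤⇒CappedBy m _ (All.tabulate (≤m ∘ ∈-joinOnLetter⁻ m β′ βs))
    , Nested-joinOnLetter m β′ βs (Nested-++⁻ʳ β _ p) ds (AllP.++⁻ʳ β <m))
  where
  ≤m : ∀ {a} → a ≡ m ⊎ a ∈ concat (β′ ∷ βs) → a ≤ m
  ≤m (inj₁ refl) = ℕP.≤-refl
  ≤m (inj₂ a∈)   = ℕP.<⇒≤ (All.lookup <m (∈-++⁺ʳ β a∈))
  apart : ∀ {x} → x ∈ β → x ∉ m ∷ joinOnLetter m (β′ ∷ βs)
  apart x∈ (here refl) = ℕP.<-irrefl refl (All.lookup <m (∈-++⁺ˡ x∈))
  apart {x} x∈ (there x∈′) with ∈-joinOnLetter⁻ m β′ βs x∈′
  ... | inj₁ refl = ℕP.<-irrefl refl (All.lookup <m (∈-++⁺ˡ x∈))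
  ... | inj₂ x∈βs = d x x∈ x∈βs

-- A letter of βⱼ reappearing in a later βₖ would enclose an m, which is larger.
Nested-joinOnLetter⇒Disjointᵗ : ∀ m β γs → Nested (joinOnLetter m (β ∷ γs)) → All (_< m) (concat (β ∷ γs)) →
                                Disjointᵗ (β ∷ γs)
Nested-joinOnLetter⇒Disjointᵗ m β []        p <m = (λ a _ ()) , tt
Nested-joinOnLetter⇒Disjointᵗ m β (β′ ∷ βs) p <m =
    (λ a a∈β a∈βs → ℕP.<-irrefl refl (ℕP.<-≤-trans (All.lookup <m (∈-++⁺ˡ a∈β))
        (proj₁ (Nested-++⇒CappedBy β (m ∷ joinOnLetter m (β′ ∷ βs)) p a∈β) (∈-joinOnLetter⁺ m β′ βs a∈βs))))
  , Nested-joinOnLetter⇒Disjointᵗ m β′ βs (proj₂ (Nested-++⁻ʳ β (m ∷ joinOnLetter m (β′ ∷ βs)) p)) (AllP.++⁻ʳ β <m)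

-- Assembling a tuple around the component of its largest letter

assemble : ℕ → List Word → List Word → List Word → List Word
assemble m A βs B = A ++ joinOnLetter m βs ∷ B

module Assembled (m : ℕ) (A : List Word) (β : Word) (γs B : List Word) where

  L : List Word
  L = A ++ β ∷ γs

  G : Word
  G = joinOnLetter m (β ∷ γs)

  concat-assemble : concat (assemble m A (β ∷ γs) B) ≡ concat A ++ G ++ concat B
  concat-assemble = sym (LP.concat-++ A (G ∷ B))

  concat-L : concat L ≡ concat A ++ concat (β ∷ γs)
  concat-L = sym (LP.concat-++ A (β ∷ γs))

  ∈-assemble⁻ : ∀ {a} → a ∈ concat (assemble m A (β ∷ γs) B) → a ≡ m ⊎ a ∈ concat L ⊎ a ∈ concat B
  ∈-assemble⁻ {a} a∈ with ∈-++⁻ (concat A) (subst (a ∈_) concat-assemble a∈)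
  ... | inj₁ a∈A = inj₂ (inj₁ (subst (a ∈_) (sym concat-L) (∈-++⁺ˡ a∈A)))
  ... | inj₂ a∈GB with ∈-++⁻ G a∈GB
  ...   | inj₂ a∈B = inj₂ (inj₂ a∈B)
  ...   | inj₁ a∈G with ∈-joinOnLetter⁻ m β γs a∈G
  ...     | inj₁ a≡m  = inj₁ a≡m
  ...     | inj₂ a∈βs = inj₂ (inj₁ (subst (a ∈_) (sym concat-L) (∈-++⁺ʳ (concat A) a∈βs)))

  ∈-assemble⁺ˡ : ∀ {a} → a ∈ concat L → a ∈ concat (assemble m A (β ∷ γs) B)
  ∈-assemble⁺ˡ {a} a∈ with ∈-++⁻ (concat A) (subst (a ∈_) concat-L a∈)
  ... | inj₁ a∈A  = subst (a ∈_) (sym concat-assemble) (∈-++⁺ˡ a∈A)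
  ... | inj₂ a∈βs = subst (a ∈_) (sym concat-assemble) (∈-++⁺ʳ (concat A) (∈-++⁺ˡ (∈-joinOnLetter⁺ m β γs a∈βs)))

  ∈-assemble⁺ʳ : ∀ {a} → a ∈ concat B → a ∈ concat (assemble m A (β ∷ γs) B)
  ∈-assemble⁺ʳ {a} a∈ = subst (a ∈_) (sym concat-assemble) (∈-++⁺ʳ (concat A) (∈-++⁺ʳ G a∈))

  occ-assemble : ∀ a → a ≢ m → occ a (concat (assemble m A (β ∷ γs) B)) ≡ occ a (concat L) + occ a (concat B)
  occ-assemble a a≢m = begin
      occ a (concat (assemble m A (β ∷ γs) B))
    ≡⟨ cong (occ a) concat-assemble ⟩
      occ a (concat A ++ G ++ concat B)
    ≡⟨ occ-++ a (concat A) _ ⟩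
      occ a (concat A) + occ a (G ++ concat B)
    ≡⟨ cong (occ a (concat A) +_) (occ-++ a G (concat B)) ⟩
      occ a (concat A) + (occ a G + occ a (concat B))
    ≡⟨ cong (λ z → occ a (concat A) + (z + occ a (concat B))) (occ-joinOnLetter a m β γs a≢m) ⟩
      occ a (concat A) + (occ a (concat (β ∷ γs)) + occ a (concat B))
    ≡⟨ sym (ℕP.+-assoc (occ a (concat A)) _ _) ⟩
      (occ a (concat A) + occ a (concat (β ∷ γs))) + occ a (concat B)
    ≡⟨ cong (_+ occ a (concat B)) (sym (trans (cong (occ a) concat-L) (occ-++ a (concat A) _))) ⟩
      occ a (concat L) + occ a (concat B)
    ∎

  occ-letter-assemble : m ∉ concat L → m ∉ concat B → occ m (concat (assemble m A (β ∷ γs) B)) ≡ length γs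
  occ-letter-assemble m∉L m∉B = begin
      occ m (concat (assemble m A (β ∷ γs) B))
    ≡⟨ cong (occ m) concat-assemble ⟩
      occ m (concat A ++ G ++ concat B)
    ≡⟨ occ-++ m (concat A) _ ⟩
      occ m (concat A) + occ m (G ++ concat B)
    ≡⟨ cong₂ _+_ (∉⇒occ≡0 m (concat A) (m∉L ∘ A⊆L)) (occ-++ m G (concat B)) ⟩
      occ m G + occ m (concat B)
    ≡⟨ cong₂ _+_ (occ-letter-joinOnLetter m β γs (m∉L ∘ βs⊆L)) (∉⇒occ≡0 m (concat B) m∉B) ⟩
      length γs + 0
    ≡⟨ ℕP.+-identityʳ _ ⟩
      length γs
    ∎
    where
    A⊆L : ∀ {a} → a ∈ concat A → a ∈ concat L
    A⊆L a∈ = subst (_ ∈_) (sym concat-L) (∈-++⁺ˡ a∈)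
    βs⊆L : ∀ {a} → a ∈ concat (β ∷ γs) → a ∈ concat L
    βs⊆L a∈ = subst (_ ∈_) (sym concat-L) (∈-++⁺ʳ (concat A) a∈)

  concat-L≡deleteAll : m ∉ concat L → concat L ≡ deleteAll m (concat A ++ G)
  concat-L≡deleteAll m∉L = begin
      concat L
    ≡⟨ concat-L ⟩
      concat A ++ concat (β ∷ γs)
    ≡⟨ sym (cong₂ _++_ (deleteAll-∉ m (concat A) (m∉L ∘ subst (_ ∈_) (sym concat-L) ∘ ∈-++⁺ˡ))
                       (deleteAll-joinOnLetter m β γs (m∉L ∘ subst (_ ∈_) (sym concat-L) ∘ ∈-++⁺ʳ (concat A)))) ⟩
      deleteAll m (concat A) ++ deleteAll m G
    ≡⟨ sym (deleteAll-++ m (concat A) G) ⟩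
      deleteAll m (concat A ++ G)
    ∎

  Nested-assemble⁻ : m ∉ concat L → Nested (concat (assemble m A (β ∷ γs) B)) → Nested (concat L) × Nested (concat B)
  Nested-assemble⁻ m∉L nested =
      subst Nested (sym (concat-L≡deleteAll m∉L)) (Nested-deleteAll m _ (Nested-++⁻ˡ (concat A ++ G) (concat B) nested′))
    , Nested-++⁻ʳ (concat A ++ G) (concat B) nested′
    where
    nested′ = subst Nested (trans concat-assemble (sym (LP.++-assoc (concat A) G (concat B)))) nested

  Disjointᵗ-assemble⁻ : All (_< m) (concat (β ∷ γs)) → Nested (concat (assemble m A (β ∷ γs) B)) →
                        Disjointᵗ (assemble m A (β ∷ γs) B) → Disjointᵗ L × Disjointᵗ B
  Disjointᵗ-assemble⁻ <m nested disjoint with Disjointᵗ-++⁻ A (G ∷ B) disjoint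
  ... | dA , (_ , dB) , sepA =
      Disjointᵗ-++⁺ A (β ∷ γs) dA (Nested-joinOnLetter⇒Disjointᵗ m β γs nestedG <m)
        (λ a∈A a∈βs → sepA a∈A (∈-++⁺ˡ (∈-joinOnLetter⁺ m β γs a∈βs)))
    , dB
    where
    nestedG : Nested G
    nestedG = Nested-++⁻ˡ G (concat B) (Nested-++⁻ʳ (concat A) (G ++ concat B) (subst Nested concat-assemble nested))

  module _ (m∉L : m ∉ concat L) (m∉B : m ∉ concat B) (sep : ∀ {a} → a ∈ concat L → a ∉ concat B)
           (disjointL : Disjointᵗ L) where

    private
      A⊆L : ∀ {a} → a ∈ concat A → a ∈ concat L
      A⊆L a∈ = subst (_ ∈_) (sym concat-L) (∈-++⁺ˡ a∈)

      βs⊆L : ∀ {a} → a ∈ concat (β ∷ γs) → a ∈ concat L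
      βs⊆L a∈ = subst (_ ∈_) (sym concat-L) (∈-++⁺ʳ (concat A) a∈)

      split-disjointL = Disjointᵗ-++⁻ A (β ∷ γs) disjointL

      A∉G : ∀ {a} → a ∈ concat A → a ∉ G
      A∉G a∈A a∈G with ∈-joinOnLetter⁻ m β γs a∈G
      ... | inj₁ refl  = m∉L (A⊆L a∈A)
      ... | inj₂ a∈βs = proj₂ (proj₂ split-disjointL) a∈A a∈βs

      G∉B : ∀ {a} → a ∈ G → a ∉ concat B
      G∉B a∈G with ∈-joinOnLetter⁻ m β γs a∈G
      ... | inj₁ refl  = m∉B
      ... | inj₂ a∈βs = sep (βs⊆L a∈βs)

    Nested-assemble⁺ : All (_< m) (concat (β ∷ γs)) → Nested (concat L) → Nested (concat B) →
                       Nested (concat (assemble m A (β ∷ γs) B))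
    Nested-assemble⁺ <m nestedL nestedB =
      subst Nested (sym (trans concat-assemble (sym (LP.++-assoc (concat A) G (concat B)))))
        (Nested-++⁺ (concat A ++ G) (concat B) AG∉B
          (Nested-++⁺ (concat A) G A∉G (Nested-++⁻ˡ (concat A) _ nestedL′)
            (Nested-joinOnLetter m β γs (Nested-++⁻ʳ (concat A) _ nestedL′) (proj₁ (proj₂ split-disjointL)) <m))
          nestedB)
      where
      nestedL′ = subst Nested concat-L nestedL
      AG∉B : ∀ {a} → a ∈ concat A ++ G → a ∉ concat B
      AG∉B a∈ = [ sep ∘ A⊆L , G∉B ]′ (∈-++⁻ (concat A) a∈)

    Disjointᵗ-assemble⁺ : Disjointᵗ B → Disjointᵗ (assemble m A (β ∷ γs) B)
    Disjointᵗ-assemble⁺ disjointB =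
      Disjointᵗ-++⁺ A (G ∷ B) (proj₁ split-disjointL) ((λ a → G∉B) , disjointB)
        λ a∈A a∈GB → [ A∉G a∈A , sep (A⊆L a∈A) ]′ (∈-++⁻ G a∈GB)

-- Cutting and gluing sortable tuples at the largest letter

++-injective : ∀ {A : Set} (xs xs′ ys ys′ : List A) → length xs ≡ length xs′ → xs ++ ys ≡ xs′ ++ ys′ →
               xs ≡ xs′ × ys ≡ ys′
++-injective []       []         ys ys′ _   e = refl , e
++-injective (x ∷ xs) (x′ ∷ xs′) ys ys′ len e with LP.∷-injective e
... | refl , e′ with ++-injective xs xs′ ys ys′ (ℕP.suc-injective len) e′
...   | refl , e″ = refl , e″

i+b≰i : ∀ i b → 1 ≤ b → i + b ≰ i
i+b≰i i b 1≤b i+b≤i = ℕP.<-irrefl refl (ℕP.≤-trans (subst (_≤ i + b) (ℕP.+-comm i 1) (ℕP.+-monoʳ-≤ i 1≤b)) i+b≤i)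

unshift : ℕ → List Word → List Word
unshift i = map (map (_∸ i))

unshift-shift : ∀ i t → unshift i (map (map (i +_)) t) ≡ t
unshift-shift i t = begin
    unshift i (map (map (i +_)) t)
  ≡⟨ sym (LP.map-∘ t) ⟩
    map (map (_∸ i) ∘ map (i +_)) t
  ≡⟨ LP.map-cong (λ w → trans (sym (LP.map-∘ w)) (trans (LP.map-cong (ℕP.m+n∸m≡n i) w) (LP.map-id w))) t ⟩
    map (λ w → w) t
  ≡⟨ LP.map-id t ⟩
    t
  ∎

-- If t = assemble m A (β ∷ β′ ∷ βs) B is a sortable tuple r-permutation of [m], m = n + 1, then
-- S (sortEach L) · S (sortEach B) = 12⋯n forces the letters of L to be [i] and those of B to be
-- i + [n - i], for i the length of S (sortEach L).
module Decomposition (r n : ℕ) (A : List Word) (β β′ : Word) (βs B : List Word)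
  (valid : IsTupleRPerm r (suc n) (assemble (suc n) A (β ∷ β′ ∷ βs) B))
  (sortable : TwoStackSortable (suc n) (assemble (suc n) A (β ∷ β′ ∷ βs) B))
  (m∉L : suc n ∉ concat (A ++ β ∷ β′ ∷ βs)) (m∉B : suc n ∉ concat B) where

  open Assembled (suc n) A β (β′ ∷ βs) B

  private
    m = suc n
    t = assemble m A (β ∷ β′ ∷ βs) B
    letters = proj₁ valid
    each    = proj₁ (proj₂ valid)
    nested  = proj₁ (proj₂ (proj₂ valid))

    X = S (sortEach L)
    Y = S (sortEach B)

  i : ℕ
  i = length X

  private
    XY≡range : X ++ Y ≡ range n
    XY≡range = LP.∷ʳ-injectiveˡ (X ++ Y) (range n) (begin
        (X ++ Y) ++ [ m ]
      ≡⟨ LP.++-assoc X Y [ m ] ⟩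
        X ++ Y ++ [ m ]
      ≡⟨ sym (S-sortEach-split m A β β′ βs B m∉L m∉B (≤m ∈-assemble⁺ˡ) (≤m ∈-assemble⁺ʳ)) ⟩
        S (sortEach t)
      ≡⟨ sortable ⟩
        range (suc n)
      ≡⟨ range-suc n ⟩
        range n ++ [ m ]
      ∎)
      where
      ≤m : ∀ {u} → (∀ {a} → a ∈ u → a ∈ concat t) → All (_≤ m) u
      ≤m ⊆t = All.tabulate (proj₂ ∘ All.lookup letters ∘ ⊆t)

  i≤n : i ≤ n
  i≤n = subst (i ≤_) (trans (sym (LP.length-++ X)) (trans (cong length XY≡range) (length-range n))) (ℕP.m≤m+n i (length Y))

  private
    X,Y≡ : X ≡ range i × Y ≡ map (i +_) (range (n ∸ i))
    X,Y≡ = ++-injective X (range i) Y _ (sym (length-range i))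
             (trans XY≡range (trans (cong range (sym (ℕP.m+[n∸m]≡n i≤n))) (range-+ i (n ∸ i))))

    inL : ∀ {a} → a ∈ concat L → InRange i a
    inL a∈ = ∈-range⁻ (subst (_ ∈_) (proj₁ X,Y≡) (∈-S⁺ (sortEach L) (∈-sortEach⁺ L a∈)))

    inB : ∀ {a} → a ∈ concat B → ∃ λ b → InRange (n ∸ i) b × a ≡ i + b
    inB a∈ with ∈-map⁻ (i +_) (subst (_ ∈_) (proj₂ X,Y≡) (∈-S⁺ (sortEach B) (∈-sortEach⁺ B a∈)))
    ... | b , b∈ , e = b , ∈-range⁻ b∈ , e

    ≤i⇒∉B : ∀ {a} → a ≤ i → a ∉ concat B
    ≤i⇒∉B a≤i a∈ with inB a∈
    ... | b , (1≤b , _) , refl = i+b≰i i b 1≤b a≤i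

    i+b≤n : ∀ {b} → InRange (n ∸ i) b → i + b ≤ n
    i+b≤n (_ , b≤) = ℕP.≤-trans (ℕP.+-monoʳ-≤ i b≤) (ℕP.≤-reflexive (ℕP.m+[n∸m]≡n i≤n))

    <m : All (_< m) (concat (β ∷ β′ ∷ βs))
    <m = All.tabulate λ a∈ → s≤s (ℕP.≤-trans (proj₂ (inL (subst (_ ∈_) (sym concat-L) (∈-++⁺ʳ (concat A) a∈)))) i≤n)

    disjoint = Disjointᵗ-assemble⁻ <m nested (proj₂ (proj₂ (proj₂ valid)))

  L-sortable : TwoStackSortable i L
  L-sortable = proj₁ X,Y≡

  L-valid : IsTupleRPerm r i L
  L-valid = All.tabulate inL , L-each , proj₁ (Nested-assemble⁻ m∉L nested) , proj₁ disjoint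
    where
    L-each : EachExactly r i (concat L)
    L-each a (1≤a , a≤i) = begin
        occ a (concat L)
      ≡⟨ sym (ℕP.+-identityʳ _) ⟩
        occ a (concat L) + 0
      ≡⟨ cong (occ a (concat L) +_) (sym (∉⇒occ≡0 a (concat B) (≤i⇒∉B a≤i))) ⟩
        occ a (concat L) + occ a (concat B)
      ≡⟨ sym (occ-assemble a (λ a≡m → ℕP.<-irrefl a≡m (s≤s (ℕP.≤-trans a≤i i≤n)))) ⟩
        occ a (concat t)
      ≡⟨ each a (1≤a , ℕP.m≤n⇒m≤1+n (ℕP.≤-trans a≤i i≤n)) ⟩
        r
      ∎

  R : List Word
  R = unshift i B

  shift-R : map (map (i +_)) R ≡ B
  shift-R = trans (sym (LP.map-∘ B)) (trans (LP.map-cong-local (All.tabulate λ {w} w∈ →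
      trans (sym (LP.map-∘ w)) (trans (LP.map-cong-local (All.tabulate λ {x} x∈ → i+[x∸i]≡x (inB (∈-concat⁺′ x∈ w∈))))
            (LP.map-id w))))
    (LP.map-id B))
    where
    i+[x∸i]≡x : ∀ {x} → (∃ λ b → InRange (n ∸ i) b × x ≡ i + b) → i + (x ∸ i) ≡ x
    i+[x∸i]≡x (b , _ , refl) = cong (i +_) (ℕP.m+n∸m≡n i b)

  R-sortable : TwoStackSortable (n ∸ i) R
  R-sortable = LP.map-injective (ℕP.+-cancelˡ-≡ i _ _) (begin
      map (i +_) (S (sortEach R))
    ≡⟨ sym (S-shift i (sortEach R)) ⟩
      S (map (i +_) (sortEach R))
    ≡⟨ cong S (sym (sortEach-shift i R)) ⟩
      S (sortEach (map (map (i +_)) R))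
    ≡⟨ cong (S ∘ sortEach) shift-R ⟩
      Y
    ≡⟨ proj₂ X,Y≡ ⟩
      map (i +_) (range (n ∸ i))
    ∎)

  R-valid : IsTupleRPerm r (n ∸ i) R
  R-valid = All.tabulate R-letters , R-each
          , Nested-shift⁻ i (concat R) (subst Nested concat-B (proj₂ (Nested-assemble⁻ m∉L nested)))
          , Disjointᵗ-shift⁻ i R (subst Disjointᵗ (sym shift-R) (proj₂ disjoint))
    where
    concat-B : concat B ≡ map (i +_) (concat R)
    concat-B = trans (cong concat (sym shift-R)) (LP.concat-map R)
    R-letters : ∀ {b} → b ∈ concat R → InRange (n ∸ i) b
    R-letters {b} b∈ with ∈-map⁻ (_∸ i) (subst (b ∈_) (LP.concat-map B) b∈)
    ... | x , x∈ , refl with inB x∈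
    ...   | c , c∈ , refl = subst (InRange (n ∸ i)) (sym (ℕP.m+n∸m≡n i c)) c∈
    R-each : EachExactly r (n ∸ i) (concat R)
    R-each b b∈ = begin
        occ b (concat R)
      ≡⟨ sym (occ-shift i b (concat R)) ⟩
        occ (i + b) (map (i +_) (concat R))
      ≡⟨ cong (occ (i + b)) (sym concat-B) ⟩
        occ (i + b) (concat B)
      ≡⟨ cong (_+ occ (i + b) (concat B)) (sym (∉⇒occ≡0 (i + b) (concat L) (λ ib∈ → i+b≰i i b (proj₁ b∈) (proj₂ (inL ib∈))))) ⟩
        occ (i + b) (concat L) + occ (i + b) (concat B)
      ≡⟨ sym (occ-assemble (i + b) (λ ib≡m → ℕP.<-irrefl ib≡m (s≤s (i+b≤n b∈)))) ⟩
        occ (i + b) (concat t)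
      ≡⟨ each (i + b) (ℕP.≤-trans (proj₁ b∈) (ℕP.m≤n+m b i) , ℕP.m≤n⇒m≤1+n (i+b≤n b∈)) ⟩
        r
      ∎

module Composition (r n i : ℕ) (A : List Word) (β β′ : Word) (βs R : List Word) (i≤n : i ≤ n)
  (L-valid : IsTupleRPerm r i (A ++ β ∷ β′ ∷ βs)) (L-sortable : TwoStackSortable i (A ++ β ∷ β′ ∷ βs))
  (R-valid : IsTupleRPerm r (n ∸ i) R) (R-sortable : TwoStackSortable (n ∸ i) R)
  (|β′∷βs| : length (β′ ∷ βs) ≡ r) where

  B : List Word
  B = map (map (i +_)) R

  open Assembled (suc n) A β (β′ ∷ βs) B

  private
    m = suc n
    t = assemble m A (β ∷ β′ ∷ βs) B

    concat-B : concat B ≡ map (i +_) (concat R)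
    concat-B = LP.concat-map R

    inL : ∀ {a} → a ∈ concat L → InRange i a
    inL = All.lookup (proj₁ L-valid)

    inB : ∀ {a} → a ∈ concat B → ∃ λ b → InRange (n ∸ i) b × a ≡ i + b
    inB {a} a∈ with ∈-map⁻ (i +_) (subst (a ∈_) concat-B a∈)
    ... | b , b∈ , e = b , All.lookup (proj₁ R-valid) b∈ , e

    i+b≤n : ∀ {b} → InRange (n ∸ i) b → i + b ≤ n
    i+b≤n (_ , b≤) = ℕP.≤-trans (ℕP.+-monoʳ-≤ i b≤) (ℕP.≤-reflexive (ℕP.m+[n∸m]≡n i≤n))

    L∉B : ∀ {a} → a ∈ concat L → a ∉ concat B
    L∉B a∈L a∈B with inB a∈B
    ... | b , b∈ , refl = i+b≰i i b (proj₁ b∈) (proj₂ (inL a∈L))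

    m∉B : m ∉ concat B
    m∉B m∈ with inB m∈
    ... | b , b∈ , e = ℕP.<-irrefl (sym e) (s≤s (i+b≤n b∈))

    ≤n-L : ∀ {a} → a ∈ concat L → a ≤ n
    ≤n-L a∈ = ℕP.≤-trans (proj₂ (inL a∈)) i≤n

  m∉L : suc n ∉ concat (A ++ β ∷ β′ ∷ βs)
  m∉L m∈ = ℕP.<-irrefl refl (s≤s (ℕP.≤-trans (proj₂ (inL m∈)) i≤n))

  t-sortable : TwoStackSortable (suc n) t
  t-sortable = begin
      S (sortEach t)
    ≡⟨ S-sortEach-split m A β β′ βs B m∉L m∉B (All.tabulate (ℕP.m≤n⇒m≤1+n ∘ ≤n-L)) (All.tabulate (≤m ∘ inB)) ⟩
      S (sortEach L) ++ S (sortEach B) ++ [ m ]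
    ≡⟨ cong₂ (λ X Y → X ++ Y ++ [ m ]) L-sortable
         (trans (cong S (sortEach-shift i R)) (trans (S-shift i (sortEach R)) (cong (map (i +_)) R-sortable))) ⟩
      range i ++ map (i +_) (range (n ∸ i)) ++ [ m ]
    ≡⟨ sym (LP.++-assoc (range i) _ _) ⟩
      (range i ++ map (i +_) (range (n ∸ i))) ++ [ m ]
    ≡⟨ cong (_++ [ m ]) (trans (sym (range-+ i (n ∸ i))) (cong range (ℕP.m+[n∸m]≡n i≤n))) ⟩
      range n ++ [ m ]
    ≡⟨ sym (range-suc n) ⟩
      range (suc n)
    ∎
    where
    ≤m : ∀ {a} → (∃ λ b → InRange (n ∸ i) b × a ≡ i + b) → a ≤ m
    ≤m (b , b∈ , refl) = ℕP.m≤n⇒m≤1+n (i+b≤n b∈)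

  private
    t-letters : LettersIn (suc n) (concat t)
    t-letters = All.tabulate ([ (λ { refl → s≤s z≤n , ℕP.≤-refl }) , [ fromL , fromB ∘ inB ]′ ]′ ∘ ∈-assemble⁻)
      where
      fromL : ∀ {a} → a ∈ concat L → InRange (suc n) a
      fromL a∈ = proj₁ (inL a∈) , ℕP.m≤n⇒m≤1+n (≤n-L a∈)
      fromB : ∀ {a} → (∃ λ b → InRange (n ∸ i) b × a ≡ i + b) → InRange (suc n) a
      fromB (b , b∈ , refl) = ℕP.≤-trans (proj₁ b∈) (ℕP.m≤n+m b i) , ℕP.m≤n⇒m≤1+n (i+b≤n b∈)

    t-each : EachExactly r (suc n) (concat t)
    t-each a (1≤a , a≤m) with a ≟ m
    ... | yes refl = trans (occ-letter-assemble m∉L m∉B) |β′∷βs|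
    ... | no a≢m with a ≤? i
    ...   | yes a≤i = begin
        occ a (concat t)
      ≡⟨ occ-assemble a a≢m ⟩
        occ a (concat L) + occ a (concat B)
      ≡⟨ cong (occ a (concat L) +_) (∉⇒occ≡0 a (concat B) a∉B) ⟩
        occ a (concat L) + 0
      ≡⟨ ℕP.+-identityʳ _ ⟩
        occ a (concat L)
      ≡⟨ proj₁ (proj₂ L-valid) a (1≤a , a≤i) ⟩
        r
      ∎
      where
      a∉B : a ∉ concat B
      a∉B a∈ with inB a∈
      ... | b , b∈ , refl = i+b≰i i b (proj₁ b∈) a≤i
    ...   | no a≰i = begin
        occ a (concat t)
      ≡⟨ occ-assemble a a≢m ⟩
        occ a (concat L) + occ a (concat B)
      ≡⟨ cong (_+ occ a (concat B)) (∉⇒occ≡0 a (concat L) (a≰i ∘ proj₂ ∘ inL)) ⟩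
        occ a (concat B)
      ≡⟨ cong (occ a) concat-B ⟩
        occ a (map (i +_) (concat R))
      ≡⟨ cong (λ x → occ x (map (i +_) (concat R))) (sym (ℕP.m+[n∸m]≡n (ℕP.<⇒≤ i<a))) ⟩
        occ (i + (a ∸ i)) (map (i +_) (concat R))
      ≡⟨ occ-shift i (a ∸ i) (concat R) ⟩
        occ (a ∸ i) (concat R)
      ≡⟨ proj₁ (proj₂ R-valid) (a ∸ i) (ℕP.m<n⇒0<n∸m i<a , ℕP.∸-monoˡ-≤ i (ℕP.≤-pred (ℕP.≤∧≢⇒< a≤m a≢m))) ⟩
        r
      ∎
      where
      i<a : i < a
      i<a = ℕP.≰⇒> a≰i

  t-valid : IsTupleRPerm r (suc n) t
  t-valid = t-letters , t-each
          , Nested-assemble⁺ m∉L m∉B L∉B (proj₂ (proj₂ (proj₂ L-valid))) (All.tabulate (s≤s ∘ ≤n-L ∘ βs⊆L))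
              (proj₁ (proj₂ (proj₂ L-valid))) (subst Nested (sym concat-B) (Nested-shift⁺ i (concat R) (proj₁ (proj₂ (proj₂ R-valid)))))
          , Disjointᵗ-assemble⁺ m∉L m∉B L∉B (proj₂ (proj₂ (proj₂ L-valid))) (Disjointᵗ-shift⁺ i R (proj₂ (proj₂ (proj₂ R-valid))))
    where
    βs⊆L : ∀ {a} → a ∈ concat (β ∷ β′ ∷ βs) → a ∈ concat L
    βs⊆L a∈ = subst (_ ∈_) (sym concat-L) (∈-++⁺ʳ (concat A) a∈)

-- The bijection behind the functional equation

before : ℕ → List Word → List Word
before m []      = []
before m (w ∷ t) = if occursᵇ m w then [] else w ∷ before m t

containing : ℕ → List Word → Word
containing m []      = []
containing m (w ∷ t) = if occursᵇ m w then w else containing m t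

after : ℕ → List Word → List Word
after m []      = []
after m (w ∷ t) = if occursᵇ m w then t else after m t

locate : ∀ m t → m ∈ concat t →
         t ≡ before m t ++ containing m t ∷ after m t × m ∉ concat (before m t) × m ∈ containing m t
locate m (w ∷ t) m∈ with occursᵇ m w in eq
... | true  = refl , (λ ()) , occursᵇ⇒∈ m w eq
... | false with ∈-++⁻ w m∈
...   | inj₁ m∈w = ⊥-elim (occursᵇ-false⇒∉ m w eq m∈w)
...   | inj₂ m∈t with locate m t m∈t
...     | t≡ , m∉ , m∈′ = cong (w ∷_) t≡ , [ occursᵇ-false⇒∉ m w eq , m∉ ]′ ∘ ∈-++⁻ w , m∈′

locate-++ : ∀ m A G B → m ∉ concat A → m ∈ G →
            before m (A ++ G ∷ B) ≡ A × containing m (A ++ G ∷ B) ≡ G × after m (A ++ G ∷ B) ≡ B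
locate-++ m []      G B m∉ m∈ rewrite ∈⇒occursᵇ m G m∈ = refl , refl , refl
locate-++ m (w ∷ A) G B m∉ m∈ rewrite ∉⇒occursᵇ-false m w (m∉ ∘ ∈-++⁺ˡ) with locate-++ m A G B (m∉ ∘ ∈-++⁺ʳ w) m∈
... | A≡ , G≡ , B≡ = cong (w ∷_) A≡ , G≡ , B≡

-- (a , j , R , L): R is a j-tuple on [a] and L a tuple on [n - a] ending in the r + 1 pieces
-- of the component of the largest letter.
Halves : Set
Halves = ℕ × ℕ × List Word × List Word

compose : ℕ → ℕ → Halves → List Word
compose n k (a , j , R , L) = assemble (suc n) (take (k ∸ j ∸ 1) L) (drop (k ∸ j ∸ 1) L) (map (map ((n ∸ a) +_)) R)

decomposeWith : ℕ → List Word → List Word → Halves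
decomposeWith n L B = n ∸ length (S (sortEach L)) , length B , unshift (length (S (sortEach L))) B , L

decompose : ℕ → List Word → Halves
decompose n t = decomposeWith n (before (suc n) t ++ splitOnLetter (suc n) (containing (suc n) t)) (after (suc n) t)

-- The condition is that of the coefficient of z̄^(k - j + r) in P − Σ_{i ≤ r} pᵢ z̄ⁱ, i.e. j < k.
halvesAt : ℕ → ℕ → ℕ → ℕ → ℕ → List Halves
halvesAt r n k a j = if k ∸ j + r ≤ᵇ r then []
  else map (λ (R , L) → a , j , R , L) (cartesianProduct (sortableTuples r a j) (sortableTuples r (n ∸ a) (k ∸ j + r)))

halves : ℕ → ℕ → ℕ → List Halves
halves r n k = concatMap (λ a → concatMap (halvesAt r n k a) (upTo (suc k))) (upTo (suc n))

<⇒∸+≤ᵇ-false : ∀ k j r → j < k → (k ∸ j + r ≤ᵇ r) ≡ false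
<⇒∸+≤ᵇ-false k j r j<k with k ∸ j + r ≤ᵇ r in eq
... | false = refl
... | true  = ⊥-elim (ℕP.<-irrefl refl (ℕP.≤-trans (ℕP.+-monoˡ-≤ r (ℕP.m<n⇒0<n∸m j<k)) (≤ᵇ-true⇒≤ eq)))

∸+≤ᵇ-false⇒< : ∀ k j r → (k ∸ j + r ≤ᵇ r) ≡ false → j < k
∸+≤ᵇ-false⇒< k j r eq with ℕP.<-cmp j k
... | tri< j<k _ _ = j<k
... | tri≈ _ refl _ rewrite ℕP.n∸n≡0 j | ≤⇒≤ᵇ-true (ℕP.≤-refl {r}) = ⊥-elim (false≢true (sym eq))
... | tri> _ _ k<j rewrite ℕP.m≤n⇒m∸n≡0 (ℕP.<⇒≤ k<j) | ≤⇒≤ᵇ-true (ℕP.≤-refl {r}) = ⊥-elim (false≢true (sym eq))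

InHalves : ℕ → ℕ → ℕ → Halves → Set
InHalves r n k (a , j , R , L) = a ≤ n × j < k × R ∈ sortableTuples r a j × L ∈ sortableTuples r (n ∸ a) (k ∸ j + r)

∈-halvesAt⁻ : ∀ r n k a j {h} → h ∈ halvesAt r n k a j →
              ∃₂ λ R L → h ≡ (a , j , R , L) × j < k × R ∈ sortableTuples r a j × L ∈ sortableTuples r (n ∸ a) (k ∸ j + r)
∈-halvesAt⁻ r n k a j h∈ with k ∸ j + r ≤ᵇ r in eq
... | true  = case h∈ of λ ()
... | false with ∈-map⁻ (λ (R , L) → a , j , R , L) h∈
...   | (R , L) , RL∈ , refl with ∈-cartesianProduct⁻ (sortableTuples r a j) _ RL∈
...     | R∈ , L∈ = R , L , refl , ∸+≤ᵇ-false⇒< k j r eq , R∈ , L∈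

∈-halves⁻ : ∀ r n k {h} → h ∈ halves r n k → InHalves r n k h
∈-halves⁻ r n k h∈ with ∈-concatMap⁻′ (λ a → concatMap (halvesAt r n k a) (upTo (suc k))) (upTo (suc n)) h∈
... | a , a∈ , h∈′ with ∈-concatMap⁻′ (halvesAt r n k a) (upTo (suc k)) h∈′
...   | j , _ , h∈″ with ∈-halvesAt⁻ r n k a j h∈″
...     | R , L , refl , j<k , R∈ , L∈ = ℕP.≤-pred (∈-upTo⁻ a∈) , j<k , R∈ , L∈

∈-halves⁺ : ∀ r n k {a j R L} → InHalves r n k (a , j , R , L) → (a , j , R , L) ∈ halves r n k
∈-halves⁺ r n k {a} {j} {R} {L} (a≤n , j<k , R∈ , L∈) =
  ∈-concatMap⁺′ (λ a → concatMap (halvesAt r n k a) (upTo (suc k))) (∈-upTo⁺ (s≤s a≤n))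
    (∈-concatMap⁺′ (halvesAt r n k a) (∈-upTo⁺ (ℕP.m≤n⇒m≤1+n j<k)) halvesAt∋)
  where
  halvesAt∋ : (a , j , R , L) ∈ halvesAt r n k a j
  halvesAt∋ rewrite <⇒∸+≤ᵇ-false k j r j<k = ∈-map⁺ (λ (R , L) → a , j , R , L) (∈-cartesianProduct⁺ R∈ L∈)

Unique-halves : ∀ r n k → Unique (halves r n k)
Unique-halves r n k =
  Unique-concatMap⁺ (λ a → concatMap (halvesAt r n k a) (upTo (suc k))) proj₁ (UniqueP.upTo⁺ (suc n))
    (λ a _ → Unique-concatMap⁺ (halvesAt r n k a) (proj₁ ∘ proj₂) (UniqueP.upTo⁺ (suc k))
       (λ j _ → Unique-halvesAt a j) (λ j h h∈ → proj₂ (keys a j h∈)))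
    (λ a h h∈ → let (j , _ , h∈′) = ∈-concatMap⁻′ (halvesAt r n k a) (upTo (suc k)) h∈ in
                proj₁ (keys a j h∈′))
  where
  Unique-halvesAt : ∀ a j → Unique (halvesAt r n k a j)
  Unique-halvesAt a j with k ∸ j + r ≤ᵇ r
  ... | true  = AllPairs.[]
  ... | false = UniqueP.map⁺ (λ { refl → refl })
                  (UniqueP.cartesianProduct⁺ (Unique-sortableTuples r a j) (Unique-sortableTuples r (n ∸ a) (k ∸ j + r)))
  keys : ∀ a j {h} → h ∈ halvesAt r n k a j → proj₁ h ≡ a × proj₁ (proj₂ h) ≡ j
  keys a j h∈ with ∈-halvesAt⁻ r n k a j h∈
  ... | _ , _ , refl , _ = refl , refl

take-length-++ : ∀ {X : Set} (xs ys : List X) → take (length xs) (xs ++ ys) ≡ xs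
take-length-++ []       ys = refl
take-length-++ (x ∷ xs) ys = cong (x ∷_) (take-length-++ xs ys)

drop-length-++ : ∀ {X : Set} (xs ys : List X) → drop (length xs) (xs ++ ys) ≡ ys
drop-length-++ []       ys = refl
drop-length-++ (x ∷ xs) ys = drop-length-++ xs ys

splitAtLength : ∀ {X : Set} c (xs : List X) r → length xs ≡ c + suc (suc r) →
                ∃₂ λ ys x → ∃₂ λ x′ zs → xs ≡ ys ++ x ∷ x′ ∷ zs × length ys ≡ c × length zs ≡ r
splitAtLength zero    (x ∷ x′ ∷ zs) r len = [] , x , x′ , zs , refl , refl , ℕP.suc-injective (ℕP.suc-injective len)
splitAtLength (suc c) (x ∷ xs)      r len with splitAtLength c xs r (ℕP.suc-injective len)
... | ys , y , y′ , zs , xs≡ , |ys| , |zs| = x ∷ ys , y , y′ , zs , cong (x ∷_) xs≡ , cong suc |ys| , |zs|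

compose-assemble : ∀ n k a j R A βs → length A ≡ k ∸ j ∸ 1 →
                   compose n k (a , j , R , A ++ βs) ≡ assemble (suc n) A βs (map (map ((n ∸ a) +_)) R)
compose-assemble n k a j R A βs |A| rewrite sym |A| =
  cong₂ (λ A′ βs′ → assemble (suc n) A′ βs′ (map (map ((n ∸ a) +_)) R)) (take-length-++ A βs) (drop-length-++ A βs)

decompose-assemble : ∀ n A β β′ βs B → suc n ∉ concat (A ++ β ∷ β′ ∷ βs) →
                     decompose n (assemble (suc n) A (β ∷ β′ ∷ βs) B) ≡ decomposeWith n (A ++ β ∷ β′ ∷ βs) B
decompose-assemble n A β β′ βs B m∉L
  with locate-++ (suc n) A (joinOnLetter (suc n) (β ∷ β′ ∷ βs)) B (m∉L ∘ subst (_ ∈_) (LP.concat-++ A _) ∘ ∈-++⁺ˡ)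
                 (letter∈joinOnLetter (suc n) β β′ βs)
... | A≡ , G≡ , B≡ rewrite A≡ | G≡ | B≡ =
  cong (λ βs₀ → decomposeWith n (A ++ βs₀) B)
    (splitOnLetter-joinOnLetter (suc n) β (β′ ∷ βs) (m∉L ∘ subst (_ ∈_) (LP.concat-++ A _) ∘ ∈-++⁺ʳ (concat A)))

compose-inverse : ∀ r n k {h} → 1 ≤ r → InHalves r n k h →
                  compose n k h ∈ sortableTuples r (suc n) k × decompose n (compose n k h) ≡ h
compose-inverse (suc r′) n k {a , j , R , L} _ (a≤n , j<k , R∈ , L∈)
  with ∈-sortableTuples⁻ _ a j R R∈ | ∈-sortableTuples⁻ _ (n ∸ a) _ L L∈
... | |R| , R-valid , R-sortable | |L| , L-valid , L-sortable
  with splitAtLength (k ∸ j ∸ 1) L r′ (trans |L| (trans (cong (_+ suc r′) (sym 1+c≡)) (sym (ℕP.+-suc c (suc r′)))))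
  where
  c = k ∸ j ∸ 1
  1+c≡ : suc c ≡ k ∸ j
  1+c≡ = ℕP.m+[n∸m]≡n (ℕP.m<n⇒0<n∸m j<k)
... | A , β , β′ , βs , refl , |A| , |βs| = compose∈ , decompose∘compose
  where
  a≡ : n ∸ (n ∸ a) ≡ a
  a≡ = ℕP.m∸[m∸n]≡n a≤n

  open Composition (suc r′) n (n ∸ a) A β β′ βs R (ℕP.m∸n≤m n a) L-valid L-sortable
    (subst (λ x → IsTupleRPerm (suc r′) x R) (sym a≡) R-valid) (subst (λ x → TwoStackSortable x R) (sym a≡) R-sortable)
    (cong suc |βs|)

  |B| : length B ≡ j
  |B| = trans (LP.length-map _ R) |R|

  compose≡ : compose n k (a , j , R , A ++ β ∷ β′ ∷ βs) ≡ assemble (suc n) A (β ∷ β′ ∷ βs) B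
  compose≡ = compose-assemble n k a j R A (β ∷ β′ ∷ βs) |A|

  |t| : length (assemble (suc n) A (β ∷ β′ ∷ βs) B) ≡ k
  |t| = begin
      length (A ++ _ ∷ B)
    ≡⟨ LP.length-++ A ⟩
      length A + suc (length B)
    ≡⟨ cong₂ (λ x y → x + suc y) |A| |B| ⟩
      k ∸ j ∸ 1 + suc j
    ≡⟨ ℕP.+-suc (k ∸ j ∸ 1) j ⟩
      suc (k ∸ j ∸ 1) + j
    ≡⟨ cong (_+ j) (ℕP.m+[n∸m]≡n (ℕP.m<n⇒0<n∸m j<k)) ⟩
      k ∸ j + j
    ≡⟨ ℕP.m∸n+n≡m (ℕP.<⇒≤ j<k) ⟩
      k
    ∎

  compose∈ : compose n k (a , j , R , A ++ β ∷ β′ ∷ βs) ∈ sortableTuples (suc r′) (suc n) k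
  compose∈ = subst (_∈ sortableTuples (suc r′) (suc n) k) (sym compose≡)
    (∈-sortableTuples⁺ (suc r′) (suc n) k _ |t| t-valid t-sortable)

  i≡ : length (S (sortEach (A ++ β ∷ β′ ∷ βs))) ≡ n ∸ a
  i≡ = trans (cong length L-sortable) (length-range (n ∸ a))

  decompose∘compose : decompose n (compose n k (a , j , R , A ++ β ∷ β′ ∷ βs)) ≡ (a , j , R , A ++ β ∷ β′ ∷ βs)
  decompose∘compose = begin
      decompose n (compose n k (a , j , R , A ++ β ∷ β′ ∷ βs))
    ≡⟨ cong (decompose n) compose≡ ⟩
      decompose n (assemble (suc n) A (β ∷ β′ ∷ βs) B)
    ≡⟨ decompose-assemble n A β β′ βs B m∉L ⟩
      decomposeWith n (A ++ β ∷ β′ ∷ βs) B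
    ≡⟨ cong (λ i → n ∸ i , length B , unshift i B , A ++ β ∷ β′ ∷ βs) i≡ ⟩
      (n ∸ (n ∸ a) , length B , unshift (n ∸ a) B , A ++ β ∷ β′ ∷ βs)
    ≡⟨ cong₂ (λ x y → x , y , unshift (n ∸ a) B , A ++ β ∷ β′ ∷ βs) a≡ |B| ⟩
      (a , j , unshift (n ∸ a) B , A ++ β ∷ β′ ∷ βs)
    ≡⟨ cong (λ R′ → a , j , R′ , A ++ β ∷ β′ ∷ βs) (unshift-shift (n ∸ a) R) ⟩
      (a , j , R , A ++ β ∷ β′ ∷ βs)
    ∎

locate-Disjointᵗ : ∀ m t → Disjointᵗ t → m ∈ concat t →
  t ≡ before m t ++ containing m t ∷ after m t × m ∉ concat (before m t) × m ∉ concat (after m t) ×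
  occ m (concat t) ≡ occ m (containing m t)
locate-Disjointᵗ m t disjoint m∈ with locate m t m∈
... | t≡ , m∉A , m∈G = t≡ , m∉A , m∉B , occ≡
  where
  A = before m t
  G = containing m t
  B = after m t
  m∉B : m ∉ concat B
  m∉B = proj₁ (proj₁ (proj₂ (Disjointᵗ-++⁻ A (G ∷ B) (subst Disjointᵗ t≡ disjoint)))) m m∈G
  occ≡ : occ m (concat t) ≡ occ m G
  occ≡ = begin
      occ m (concat t)
    ≡⟨ cong (occ m ∘ concat) t≡ ⟩
      occ m (concat (A ++ G ∷ B))
    ≡⟨ cong (occ m) (sym (LP.concat-++ A (G ∷ B))) ⟩
      occ m (concat A ++ G ++ concat B)
    ≡⟨ trans (occ-++ m (concat A) _) (cong (occ m (concat A) +_) (occ-++ m G (concat B))) ⟩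
      occ m (concat A) + (occ m G + occ m (concat B))
    ≡⟨ cong₂ (λ x y → x + (occ m G + y)) (∉⇒occ≡0 m (concat A) m∉A) (∉⇒occ≡0 m (concat B) m∉B) ⟩
      occ m G + 0
    ≡⟨ ℕP.+-identityʳ _ ⟩
      occ m G
    ∎

assembled-form : ∀ r n t → 1 ≤ r → IsTupleRPerm r (suc n) t →
  ∃₂ λ A β → ∃₂ λ β′ βs → ∃ λ B → t ≡ assemble (suc n) A (β ∷ β′ ∷ βs) B ×
    suc n ∉ concat (A ++ β ∷ β′ ∷ βs) × suc n ∉ concat B × length (β′ ∷ βs) ≡ r
assembled-form (suc r′) n t _ (_ , each , _ , disjoint)
  with locate-Disjointᵗ (suc n) t disjoint
         (occ-pos⇒∈ (suc n) (concat t) (subst (1 ≤_) (sym (each (suc n) (s≤s z≤n , ℕP.≤-refl))) (s≤s z≤n)))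
... | t≡ , m∉A , m∉B , occ≡
  with splitAtLength 0 (splitOnLetter (suc n) (containing (suc n) t)) r′
         (trans (length-splitOnLetter (suc n) (containing (suc n) t)) (cong suc (trans (sym occ≡) (each (suc n) (s≤s z≤n , ℕP.≤-refl)))))
... | [] , β , β′ , βs , split≡ , _ , |βs| =
  A , β , β′ , βs , after m t , t≡′ , [ m∉A , m∉pieces ]′ ∘ ∈-++⁻ (concat A) ∘ subst (m ∈_) (sym (LP.concat-++ A _))
    , m∉B , cong suc |βs|
  where
  m = suc n
  A = before m t
  G = containing m t
  t≡′ : t ≡ assemble m A (β ∷ β′ ∷ βs) (after m t)
  t≡′ = trans t≡ (cong (λ G′ → A ++ G′ ∷ after m t) (trans (sym (joinOnLetter-splitOnLetter m G)) (cong (joinOnLetter m) split≡)))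
  m∉pieces : m ∉ concat (β ∷ β′ ∷ βs)
  m∉pieces m∈ with ∈-concat⁻′ (β ∷ β′ ∷ βs) m∈
  ... | p , m∈p , p∈ = letter∉piece m G (subst (p ∈_) (sym split≡) p∈) m∈p

decompose-inverse : ∀ r n k {t} → 1 ≤ r → t ∈ sortableTuples r (suc n) k →
                    decompose n t ∈ halves r n k × compose n k (decompose n t) ≡ t
decompose-inverse r n k {t} 1≤r t∈ with ∈-sortableTuples⁻ r (suc n) k t t∈
... | |t| , valid , sortable with assembled-form r n t 1≤r valid
... | A , β , β′ , βs , B , refl , m∉L , m∉B , |β′∷βs| = halves∋ , compose∘decompose
  where
  open Decomposition r n A β β′ βs B valid sortable m∉L m∉B

  L = A ++ β ∷ β′ ∷ βs

  decompose≡ : decompose n (assemble (suc n) A (β ∷ β′ ∷ βs) B) ≡ (n ∸ i , length B , R , L)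
  decompose≡ = decompose-assemble n A β β′ βs B m∉L

  |t|′ : length A + suc (length B) ≡ k
  |t|′ = trans (sym (LP.length-++ A)) |t|

  k∸|B|≡ : k ∸ length B ≡ suc (length A)
  k∸|B|≡ = begin
      k ∸ length B
    ≡⟨ cong (_∸ length B) (sym |t|′) ⟩
      length A + suc (length B) ∸ length B
    ≡⟨ cong (_∸ length B) (ℕP.+-suc (length A) (length B)) ⟩
      suc (length A) + length B ∸ length B
    ≡⟨ ℕP.m+n∸n≡m (suc (length A)) (length B) ⟩
      suc (length A)
    ∎

  i≡ : n ∸ (n ∸ i) ≡ i
  i≡ = ℕP.m∸[m∸n]≡n i≤n

  |L| : length L ≡ k ∸ length B + r
  |L| = begin
      length L
    ≡⟨ LP.length-++ A ⟩
      length A + suc (length (β′ ∷ βs))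
    ≡⟨ cong (λ x → length A + suc x) |β′∷βs| ⟩
      length A + suc r
    ≡⟨ ℕP.+-suc (length A) r ⟩
      suc (length A) + r
    ≡⟨ cong (_+ r) (sym k∸|B|≡) ⟩
      k ∸ length B + r
    ∎

  halves∋ : decompose n (assemble (suc n) A (β ∷ β′ ∷ βs) B) ∈ halves r n k
  halves∋ = subst (_∈ halves r n k) (sym decompose≡) (∈-halves⁺ r n k
    ( ℕP.m∸n≤m n i
    , subst (length B <_) |t|′ (ℕP.m≤n+m (suc (length B)) (length A))
    , ∈-sortableTuples⁺ r (n ∸ i) (length B) R (LP.length-map _ B) R-valid R-sortable
    , ∈-sortableTuples⁺ r (n ∸ (n ∸ i)) (k ∸ length B + r) L |L|
        (subst (λ x → IsTupleRPerm r x L) (sym i≡) L-valid) (subst (λ x → TwoStackSortable x L) (sym i≡) L-sortable)))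

  compose∘decompose : compose n k (decompose n (assemble (suc n) A (β ∷ β′ ∷ βs) B)) ≡ assemble (suc n) A (β ∷ β′ ∷ βs) B
  compose∘decompose = begin
      compose n k (decompose n (assemble (suc n) A (β ∷ β′ ∷ βs) B))
    ≡⟨ cong (compose n k) decompose≡ ⟩
      compose n k (n ∸ i , length B , R , A ++ β ∷ β′ ∷ βs)
    ≡⟨ compose-assemble n k (n ∸ i) (length B) R A (β ∷ β′ ∷ βs) (sym (cong (_∸ 1) k∸|B|≡)) ⟩
      assemble (suc n) A (β ∷ β′ ∷ βs) (map (map ((n ∸ (n ∸ i)) +_)) R)
    ≡⟨ cong (λ x → assemble (suc n) A (β ∷ β′ ∷ βs) (map (map (x +_)) R)) i≡ ⟩
      assemble (suc n) A (β ∷ β′ ∷ βs) (map (map (i +_)) R)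
    ≡⟨ cong (assemble (suc n) A (β ∷ β′ ∷ βs)) shift-R ⟩
      assemble (suc n) A (β ∷ β′ ∷ βs) B
    ∎

-- Counting

length-concatMap : ∀ {A B : Set} (f : A → List B) xs → length (concatMap f xs) ≡ sum (map (length ∘ f) xs)
length-concatMap f []       = refl
length-concatMap f (x ∷ xs) = trans (LP.length-++ (f x)) (cong (length (f x) +_) (length-concatMap f xs))

length-cartesianProduct : ∀ {A B : Set} (xs : List A) (ys : List B) → length (cartesianProduct xs ys) ≡ length xs * length ys
length-cartesianProduct []       ys = refl
length-cartesianProduct (x ∷ xs) ys =
  trans (LP.length-++ (map (x ,_) ys)) (cong₂ _+_ (LP.length-map (x ,_) ys) (length-cartesianProduct xs ys))

ΣZ-ι : ∀ (g : ℕ → ℕ) xs → ΣZ xs (ι_ ∘ g) ≡ ι (sum (map g xs))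
ΣZ-ι g []       = refl
ΣZ-ι g (x ∷ xs) = cong (ι (g x) +ℤ_) (ΣZ-ι g xs)

ΣZ-cong : ∀ (xs : List ℕ) {f g : ℕ → ℤ} → (∀ {x} → x ∈ xs → f x ≡ g x) → ΣZ xs f ≡ ΣZ xs g
ΣZ-cong []       f≡g = refl
ΣZ-cong (x ∷ xs) f≡g = cong₂ _+ℤ_ (f≡g (here refl)) (ΣZ-cong xs (f≡g ∘ there))

pCount-suc : ∀ r n k → 1 ≤ r → pCount r (suc n) k ≡ length (halves r n k)
pCount-suc r n k 1≤r =
  Unique-inverses⇒length≡ (Unique-sortableTuples r (suc n) k) (Unique-halves r n k) (decompose n) (compose n k)
    (decompose-inverse r n k 1≤r)
    (λ h∈ → compose-inverse r n k 1≤r (∈-halves⁻ r n k h∈))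

length-halvesAt : ∀ r n k a j →
  ι (length (halvesAt r n k a j)) ≡ Pgf r a j *ℤ divZ r (Pgf r ⊖ truncZ r (Pgf r)) (n ∸ a) (k ∸ j)
length-halvesAt r n k a j with k ∸ j + r ≤ᵇ r
... | true = sym (begin
    ι p *ℤ (ι q -ℤ ι q)
  ≡⟨ cong (ι p *ℤ_) (ℤP.+-inverseʳ (ι q)) ⟩
    ι p *ℤ ι 0
  ≡⟨ ℤP.*-zeroʳ (ι p) ⟩
    ι 0
  ∎)
  where
  p = pCount r a j
  q = pCount r (n ∸ a) (k ∸ j + r)
... | false = begin
    ι (length (map _ (cartesianProduct Rs Ls)))
  ≡⟨ cong ι_ (trans (LP.length-map _ (cartesianProduct Rs Ls)) (length-cartesianProduct Rs Ls)) ⟩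
    ι (length Rs * length Ls)
  ≡⟨ ℤP.pos-* (length Rs) (length Ls) ⟩
    ι (length Rs) *ℤ ι (length Ls)
  ≡⟨ cong (ι (length Rs) *ℤ_) (sym (ℤP.+-identityʳ (ι (length Ls)))) ⟩
    ι (length Rs) *ℤ (ι (length Ls) -ℤ ι 0)
  ∎
  where
  Rs = sortableTuples r a j
  Ls = sortableTuples r (n ∸ a) (k ∸ j + r)

Pgf-suc : ∀ r n k → 1 ≤ r → Pgf r (suc n) k ≡ rhs r (Pgf r) (suc n) k
Pgf-suc r n k 1≤r = begin
    ι (pCount r (suc n) k)
  ≡⟨ cong ι_ (pCount-suc r n k 1≤r) ⟩
    ι (length (halves r n k))
  ≡⟨ cong ι_ (trans (length-concatMap (λ a → concatMap (halvesAt r n k a) (upTo (suc k))) (upTo (suc n)))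
       (cong sum (LP.map-cong (λ a → length-concatMap (halvesAt r n k a) (upTo (suc k))) (upTo (suc n))))) ⟩
    ι (sum (map (λ a → sum (map (λ j → length (halvesAt r n k a j)) (upTo (suc k)))) (upTo (suc n))))
  ≡⟨ sym (ΣZ-ι (λ a → sum (map (λ j → length (halvesAt r n k a j)) (upTo (suc k)))) (upTo (suc n))) ⟩
    ΣZ (upTo (suc n)) (λ a → ι (sum (map (λ j → length (halvesAt r n k a j)) (upTo (suc k)))))
  ≡⟨ ΣZ-cong (upTo (suc n)) (λ {a} _ → sym (ΣZ-ι (λ j → length (halvesAt r n k a j)) (upTo (suc k)))) ⟩
    ΣZ (upTo (suc n)) (λ a → ΣZ (upTo (suc k)) (λ j → ι (length (halvesAt r n k a j))))
  ≡⟨ ΣZ-cong (upTo (suc n)) (λ {a} _ → ΣZ-cong (upTo (suc k)) (λ {j} _ → length-halvesAt r n k a j)) ⟩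
    ΣZ (upTo (suc n)) (λ a → ΣZ (upTo (suc k)) (λ j → Pgf r a j *ℤ divZ r (Pgf r ⊖ truncZ r (Pgf r)) (n ∸ a) (k ∸ j)))
  ≡⟨ sym (ℤP.+-identityˡ _) ⟩
    rhs r (Pgf r) (suc n) k
  ∎

pCount-zero : ∀ r k → pCount r 0 k ≡ 1
pCount-zero r k = Unique-inverses⇒length≡ (Unique-sortableTuples r 0 k) ([] AllPairs.∷ AllPairs.[])
  (λ _ → empties) (λ e → e)
  (λ {t} t∈ → let (|t| , (letters , _) , _) = ∈-sortableTuples⁻ r 0 k t t∈ in
              here refl , sym (trans (concat≡[]⇒empties t (no-letters letters)) (cong (λ k′ → replicate k′ []) |t|)))
  (λ { (here refl) → empties∈ , refl })
  where
  empties : List Word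
  empties = replicate k []
  no-letters : ∀ {w} → LettersIn 0 w → w ≡ []
  no-letters []                  = refl
  no-letters ((1≤x , x≤0) ∷ _) = ⊥-elim (ℕP.<-irrefl refl (ℕP.≤-trans 1≤x x≤0))
  concat≡[]⇒empties : ∀ (t : List Word) → concat t ≡ [] → t ≡ replicate (length t) []
  concat≡[]⇒empties []            _  = refl
  concat≡[]⇒empties ([] ∷ t)      e  = cong ([] ∷_) (concat≡[]⇒empties t e)
  concat-empties : ∀ k → concat (replicate k ([] {A = ℕ})) ≡ []
  concat-empties zero    = refl
  concat-empties (suc k) = concat-empties k
  sortEach-empties : ∀ k → sortEach (replicate k []) ≡ []
  sortEach-empties zero    = refl
  sortEach-empties (suc k) = sortEach-empties k
  Disjointᵗ-empties : ∀ k → Disjointᵗ (replicate k [])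
  Disjointᵗ-empties zero    = tt
  Disjointᵗ-empties (suc k) = (λ a ()) , Disjointᵗ-empties k
  empties∈ : empties ∈ sortableTuples r 0 k
  empties∈ = ∈-sortableTuples⁺ r 0 k empties (LP.length-replicate k)
    ( subst (LettersIn 0) (sym (concat-empties k)) []
    , (λ a (1≤a , a≤0) → ⊥-elim (ℕP.<-irrefl refl (ℕP.≤-trans 1≤a a≤0)))
    , subst Nested (sym (concat-empties k)) tt
    , Disjointᵗ-empties k)
    (cong S (sortEach-empties k))

SatisfiesEq-Pgf : ∀ r → 1 ≤ r → SatisfiesEq r (Pgf r)
SatisfiesEq-Pgf r 1≤r zero    k = cong ι_ (pCount-zero r k)
SatisfiesEq-Pgf r 1≤r (suc n) k = Pgf-suc r n k 1≤r

truncZ-cong : ∀ r (F G : PS) x y → F x y ≡ G x y → truncZ r F x y ≡ truncZ r G x y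
truncZ-cong r F G x y e with y ≤ᵇ r
... | true  = e
... | false = refl

rhs-suc-cong : ∀ r (F G : PS) n → (∀ a → a ≤ n → ∀ k → F a k ≡ G a k) → ∀ k → rhs r F (suc n) k ≡ rhs r G (suc n) k
rhs-suc-cong r F G n F≡G k = cong (geomZ (suc n) k +ℤ_)
  (ΣZ-cong (upTo (suc n)) λ {a} a∈ → ΣZ-cong (upTo (suc k)) λ {j} _ →
     let a≤n = ℕP.≤-pred (∈-upTo⁻ a∈)
         e   = F≡G (n ∸ a) (ℕP.m∸n≤m n a) (k ∸ j + r)
     in cong₂ _*ℤ_ (F≡G a a≤n j) (cong₂ _-ℤ_ e (truncZ-cong r F G (n ∸ a) (k ∸ j + r) e)))

SatisfiesEq-unique : ∀ r (F G : PS) → SatisfiesEq r F → SatisfiesEq r G → ∀ n a → a ≤ n → ∀ k → F a k ≡ G a k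
SatisfiesEq-unique r F G eqF eqG zero    .zero z≤n k = trans (eqF 0 k) (sym (eqG 0 k))
SatisfiesEq-unique r F G eqF eqG (suc n) a    a≤  k with ℕP.m≤n⇒m<n∨m≡n a≤
... | inj₁ a<  = SatisfiesEq-unique r F G eqF eqG n a (ℕP.≤-pred a<) k
... | inj₂ refl = trans (eqF (suc n) k)
  (trans (rhs-suc-cong r F G n (SatisfiesEq-unique r F G eqF eqG n) k) (sym (eqG (suc n) k)))

theorem6 : (r : ℕ) → 1 ≤ r →
    SatisfiesEq r (Pgf r) ×
    ((F : PS) → SatisfiesEq r F → ∀ n k → F n k ≡ Pgf r n k)
theorem6 r 1≤r =
    SatisfiesEq-Pgf r 1≤r
  , λ F eqF n k → SatisfiesEq-unique r F (Pgf r) eqF (SatisfiesEq-Pgf r 1≤r) n n ℕP.≤-refl k
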